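{- Let $b\geq 2$ be an integer. (i) For any nonnegative integers $k$ and $m$ with $k\leq m$, \[ S_b(m+k)+S_b(m-k)-2S_b(m)\leq \left[\frac{b+1}{2}\right]k . \] The constant $[(b+1)/2]$ cannot be replaced by a smaller constant: for every real $c<[(b+1)/2]$ there exist nonnegative integers $k\le m$ with $S_b(m+k)+S_b(m-k)-2S_b(m)> ck$. Moreover, if $b$ is odd, the inequality is strict whenever $1\leq k\leq m$. (ii) For any nonnegative integer $n$ and positive integer $k$, \[ \bar{s}_b(n,n+2k)\leq \bar{s}_b(n,n+k)+\frac12\left[\frac{b+1}{2}\right]. \]
   Context: For an integer $b\geq 2$ and $n\in\mathbb{Z}_{\ge 0}$, $s_b(n)$ is the sum of the base-$b$ digits of $n$, and $S_b(N)=\sum_{n=0}^{N-1}s_b(n)$ (with $S_b(0)=0$). For integers $0\leq s<t$, $\bar{s}_b(s,t)=\frac{S_b(t)-S_b(s)}{t-s}=\frac{1}{t-s}\sum_{n=s}^{t-1}s_b(n)$. $[x]$ denotes the greatest integer $\le x$. -}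

module Defs where

open import Data.Nat using (ℕ; zero; suc; _+_; _*_; _∸_; _/_; _%_; NonZero)
import Data.Integer as ℤ
open import Data.Integer using (ℤ; +_)
import Data.Rational as ℚ
open import Data.Rational using (ℚ; 0ℚ)

-- base-b digit sum with fuel; fuel n suffices for input n since n / b < n when n > 0, b ≥ 2
digitSumAux : (b : ℕ) .{{_ : NonZero b}} → ℕ → ℕ → ℕ
digitSumAux b zero    n = 0
digitSumAux b (suc f) n = n % b + digitSumAux b f (n / b)

s : (b : ℕ) .{{_ : NonZero b}} → ℕ → ℕ
s b n = digitSumAux b n n

S : (b : ℕ) .{{_ : NonZero b}} → ℕ → ℕ
S b zero    = 0
S b (suc N) = S b N + s b N

L : ℕ → ℕ
L b = (b + 1) / 2

Δ : (b : ℕ) .{{_ : NonZero b}} → ℕ → ℕ → ℤ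
Δ b m k = (+ S b (m + k) ℤ.+ + S b (m ∸ k)) ℤ.- (+ 2) ℤ.* (+ S b m)

-- s̄_b(s,t) = (S_b(t) - S_b(s)) / (t - s); only meaningful for s < t (value 0 otherwise, never used)
sbar : (b : ℕ) .{{_ : NonZero b}} → ℕ → ℕ → ℚ
sbar b s₀ t with t ∸ s₀
... | zero  = 0ℚ
... | suc d = ((+ S b t) ℤ.- (+ S b s₀)) ℚ./ suc d

module Submission where

-- Write T(a,w,h) = S(a+w+h) - S(a+h) - S(a+w) + S(a), so that
-- S(m+k) + S(m-k) - 2 S(m) = T(m-k,k,k).  Splitting [0,X) by last base-b digit gives
--   S(X) = Σ_{v<b} ( v·c_v(X) + S(c_v(X)) ),   c_v(X) = #{n < X : n ≡ v (mod b)},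
-- and from this one obtains the exact decomposition (with w = t + p b, h = t' + p' b)
--   T(a,w,h) = Σ_{v<b} ( (t' - b β_v)(p + α_v) + T(c_v(a), p + α_v, p' + β_v) ),
-- where α_v, β_v ∈ {0,1}, Σ α_v = t and Σ β_v = t'.  Strong induction on w, proving
-- simultaneously T(a,w,w) ≤ L w and T(a,w,w+1) ≤ L w (L = [(b+1)/2]), reduces the bound to
-- the elementary inequality t t' ≤ L t + (b - L) Σ α_v β_v (lemma lastDigitBound); for odd b the
-- same induction gives the strict version.  Part (ii) is part (i) divided by 2k.  Sharpness is
-- shown by explicit families: k = m = b/2 for even b, and for odd b = 2d+1 the numbers
-- k_j = d(1 + b + … + b^{j-1}), for which T(0,k_j,k_j) = L k_j - j d exactly.

open import Defs
open import Data.Nat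
open import Data.Nat.Properties
open import Data.Nat.DivMod
open import Data.Nat.Divisibility using (divides-refl)
open import Data.Nat.Induction using (<-rec)
open import Data.Nat.Tactic.RingSolver using (solve-∀)
open import Data.Integer as Z using (ℤ; +_; -_; +≤+)
import Data.Integer.Properties as ZP
import Data.Integer.Tactic.RingSolver as ZS
import Data.Rational as ℚ
open import Data.Rational using (ℚ; ½; toℚᵘ)
import Data.Rational.Properties as QP
import Data.Rational.Unnormalised as U
open import Data.Rational.Unnormalised using (mkℚᵘ; *≤*; *<*)
import Data.Rational.Unnormalised.Properties as UP
open import Data.Empty using (⊥-elim)
open import Data.Product using (Σ; ∃₂; _×_; _,_; proj₁; proj₂)
open import Data.Sum using (_⊎_; inj₁; inj₂)
open import Relation.Nullary using (yes; no)
open import Relation.Binary.Definitions using (tri<; tri≈; tri>)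
open import Relation.Binary.PropositionalEquality
  using (_≡_; _≢_; refl; sym; trans; cong; cong₂; subst; subst₂; module ≡-Reasoning)

module IntegerFacts where

  pos≥0 : ∀ m → + 0 Z.≤ + m
  pos≥0 m = +≤+ z≤n

  *≥0 : ∀ {x y} → + 0 Z.≤ x → + 0 Z.≤ y → + 0 Z.≤ x Z.* y
  *≥0 {+ m} {+ n} _ _ = subst (+ 0 Z.≤_) (ZP.pos-* m n) (pos≥0 (m * n))

  +≥0 : ∀ {x y} → + 0 Z.≤ x → + 0 Z.≤ y → + 0 Z.≤ x Z.+ y
  +≥0 = ZP.+-mono-≤

  diff≥0 : ∀ {x y} → x Z.≤ y → + 0 Z.≤ y Z.- x
  diff≥0 = ZP.i≤j⇒0≤j-i

  ≤-byDiff : ∀ x y d → y Z.- x ≡ d → + 0 Z.≤ d → x Z.≤ y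
  ≤-byDiff x y d eq p = ZP.0≤i-j⇒j≤i (subst (+ 0 Z.≤_) (sym eq) p)

  ≤-+0 : ∀ {x y} → x Z.≤ y → x Z.+ + 0 Z.≤ y
  ≤-+0 = subst (Z._≤ _) (sym (ZP.+-identityʳ _))

  +0-≤ : ∀ {x y} → x Z.+ + 0 Z.≤ y → x Z.≤ y
  +0-≤ = subst (Z._≤ _) (ZP.+-identityʳ _)

open IntegerFacts

-- The numerical inequality that closes the induction step.  Here t, t' are the last digits of
-- the two shifts (t ≤ t' ≤ t+1) and X stands for Σ α_v β_v, which is at least 0 and at least
-- t + t' - b.
lastDigitBound : ∀ b L t t' (X : ℤ) → + 0 Z.≤ X → + t Z.+ + t' Z.- + b Z.≤ X →
  t ≤ t' → t' ≤ suc t → t' ≤ b → b ≤ L + L → L ≤ b →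
  + t Z.* + t' Z.≤ + L Z.* + t Z.+ (+ b Z.- + L) Z.* X
lastDigitBound b L t t' X X≥0 X≥ t≤t' t'≤t+1 t'≤b b≤2L L≤b with t' ≤? L
... | yes t'≤L =
  ≤-byDiff _ _ _ (identity (+ b) (+ L) (+ t) (+ t') X)
    (+≥0 (*≥0 (diff≥0 (+≤+ t'≤L)) (pos≥0 t)) (*≥0 (diff≥0 (+≤+ L≤b)) X≥0))
  where identity : ∀ b L t t' X → L Z.* t Z.+ (b Z.- L) Z.* X Z.- t Z.* t' ≡ (L Z.- t') Z.* t Z.+ (b Z.- L) Z.* X
        identity = ZS.solve-∀
... | no t'≰L =
  ≤-byDiff _ _ _ (identity (+ b) (+ L) (+ t) (+ t') X)
    (+≥0 (*≥0 (diff≥0 (+≤+ L≤b)) (diff≥0 X≥)) (*≥0 (diff≥0 (+≤+ t'≤b)) (diff≥0 b≤t+L)))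
  where
    identity : ∀ b L t t' X → L Z.* t Z.+ (b Z.- L) Z.* X Z.- t Z.* t'
                 ≡ (b Z.- L) Z.* (X Z.- (t Z.+ t' Z.- b)) Z.+ (b Z.- t') Z.* (t Z.+ L Z.- b)
    identity = ZS.solve-∀
    -- t' > L forces t ≥ L, hence t + L ≥ 2L ≥ b
    b≤t+L : + b Z.≤ + t Z.+ + L
    b≤t+L = subst (+ b Z.≤_) (ZP.pos-+ t L)
              (+≤+ (≤-trans b≤2L (+-monoˡ-≤ L (≤-pred (≤-trans (≰⇒> t'≰L) t'≤t+1)))))

-- The strict variant for odd b (2L = b + 1) and equal shifts with nonzero last digit t.
lastDigitBoundStrict : ∀ b L t (X : ℤ) → + 0 Z.≤ X → + t Z.+ + t Z.- + b Z.≤ X →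
  t < b → L + L ≡ suc b → L ≤ b → 1 ≤ t →
  + t Z.* + t Z.+ + 1 Z.≤ + L Z.* + t Z.+ (+ b Z.- + L) Z.* X
lastDigitBoundStrict b L t X X≥0 X≥ t<b 2L≡b+1 L≤b 1≤t with suc t ≤? L
... | yes t<L =
  ≤-byDiff _ _ _ (identity (+ b) (+ L) (+ t) X)
    (+≥0 (+≥0 (*≥0 (diff≥0 (+≤+ t<L)) (pos≥0 t)) (diff≥0 (+≤+ 1≤t))) (*≥0 (diff≥0 (+≤+ L≤b)) X≥0))
  where identity : ∀ b L t X → L Z.* t Z.+ (b Z.- L) Z.* X Z.- (t Z.* t Z.+ Z.+ 1)
                     ≡ (L Z.- (Z.+ 1 Z.+ t)) Z.* t Z.+ (t Z.- Z.+ 1) Z.+ (b Z.- L) Z.* X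
        identity = ZS.solve-∀
... | no t≮L =
  ≤-byDiff _ _ _ (identity (+ b) (+ L) (+ t) X)
    (+≥0 (+≥0 (*≥0 (diff≥0 (+≤+ L≤b)) (diff≥0 X≥)) (*≥0 (diff≥0 (+≤+ t<b)) (diff≥0 b≤t+L))) (diff≥0 b+1≤t+L))
  where
    identity : ∀ b L t X → L Z.* t Z.+ (b Z.- L) Z.* X Z.- (t Z.* t Z.+ Z.+ 1)
                 ≡ (b Z.- L) Z.* (X Z.- (t Z.+ t Z.- b)) Z.+ (b Z.- (Z.+ 1 Z.+ t)) Z.* (t Z.+ L Z.- b)
                   Z.+ (t Z.+ L Z.- (Z.+ 1 Z.+ b))
    identity = ZS.solve-∀
    b+1≤t+L : + suc b Z.≤ + t Z.+ + L
    b+1≤t+L = subst (+ suc b Z.≤_) (ZP.pos-+ t L)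
                (+≤+ (subst (_≤ t + L) 2L≡b+1 (+-monoˡ-≤ L (≤-pred (≰⇒> t≮L)))))
    b≤t+L : + b Z.≤ + t Z.+ + L
    b≤t+L = ZP.≤-trans (+≤+ (n≤1+n b)) b+1≤t+L

averageBound : ∀ (A B Lz : ℤ) (k' : ℕ) → A Z.≤ (B Z.+ B) Z.+ Lz Z.* + suc k' →
  (A ℚ./ (2 * suc k')) ℚ.≤ (B ℚ./ suc k') ℚ.+ ½ ℚ.* (Lz ℚ./ 1)
averageBound A B Lz k' le =
  QP.toℚᵘ-cancel-≤ (UP.≤-respˡ-≃ (UP.≃-sym lhs≃) (UP.≤-respʳ-≃ (UP.≃-sym rhs≃) unnormalised))
  where
    K = + suc k'
    lhs≃ : toℚᵘ (A ℚ./ (2 * suc k')) U.≃ mkℚᵘ A _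
    lhs≃ = QP.toℚᵘ-fromℚᵘ (mkℚᵘ A _)
    rhs≃ : toℚᵘ ((B ℚ./ suc k') ℚ.+ ½ ℚ.* (Lz ℚ./ 1)) U.≃ (mkℚᵘ B k' U.+ (toℚᵘ ½ U.* mkℚᵘ Lz 0))
    rhs≃ = UP.≃-trans (QP.toℚᵘ-homo-+ (B ℚ./ suc k') (½ ℚ.* (Lz ℚ./ 1)))
             (UP.+-cong (QP.toℚᵘ-fromℚᵘ (mkℚᵘ B k'))
               (UP.≃-trans (QP.toℚᵘ-homo-* ½ (Lz ℚ./ 1))
                 (UP.*-cong (UP.≃-refl {toℚᵘ ½}) (QP.toℚᵘ-fromℚᵘ (mkℚᵘ Lz 0)))))
    identity : ∀ A B Lz K → (B Z.* Z.+ 2 Z.+ (Z.+ 1 Z.* Lz) Z.* K) Z.* (Z.+ 2 Z.* K) Z.- A Z.* (K Z.* Z.+ 2)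
                 ≡ ((B Z.+ B) Z.+ Lz Z.* K Z.- A) Z.* (K Z.* Z.+ 2)
    identity = ZS.solve-∀
    crossMultiplied : A Z.* (K Z.* + 2) Z.≤ (B Z.* + 2 Z.+ (+ 1 Z.* Lz) Z.* K) Z.* (+ 2 Z.* K)
    crossMultiplied = ≤-byDiff _ _ _ (identity A B Lz K) (*≥0 (diff≥0 le) (pos≥0 (suc k' * 2)))
    unnormalised : mkℚᵘ A (k' + suc (k' + 0)) U.≤ (mkℚᵘ B k' U.+ (toℚᵘ ½ U.* mkℚᵘ Lz 0))
    unnormalised = *≤* (subst (A Z.* (K Z.* + 2) Z.≤_)
      (cong (λ z → (B Z.* + 2 Z.+ (+ 1 Z.* Lz) Z.* K) Z.* z) (sym (ZP.pos-* 2 (suc k')))) crossMultiplied)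

beatsConstant : ∀ (c : ℚ) (L k J : ℕ) (Δ : ℤ) → c ℚ.< (+ L ℚ./ 1) →
  Δ ≡ + L Z.* + k Z.- + J → J * suc (ℚ.denominator-1 c) < k → c ℚ.* (+ k ℚ./ 1) ℚ.< (Δ ℚ./ 1)
beatsConstant c@(ℚ.mkℚ nc D _) L k J Δ c<L Δ≡ Jd<k =
  QP.toℚᵘ-cancel-< (UP.<-respˡ-≃ (UP.≃-sym lhs≃) (UP.<-respʳ-≃ (UP.≃-sym rhs≃) unnormalised))
  where
    D' = + suc D
    lhs≃ : toℚᵘ (c ℚ.* (+ k ℚ./ 1)) U.≃ (toℚᵘ c U.* mkℚᵘ (+ k) 0)
    lhs≃ = UP.≃-trans (QP.toℚᵘ-homo-* c (+ k ℚ./ 1)) (UP.*-cong (UP.≃-refl {toℚᵘ c}) (QP.toℚᵘ-fromℚᵘ (mkℚᵘ (+ k) 0)))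
    rhs≃ : toℚᵘ (Δ ℚ./ 1) U.≃ mkℚᵘ Δ 0
    rhs≃ = QP.toℚᵘ-fromℚᵘ (mkℚᵘ Δ 0)
    c<Lᵘ : toℚᵘ c U.< mkℚᵘ (+ L) 0
    c<Lᵘ = UP.<-respʳ-≃ (QP.toℚᵘ-fromℚᵘ (mkℚᵘ (+ L) 0)) (QP.toℚᵘ-mono-< c<L)
    identity : ∀ nc L k J D → (L Z.* k Z.- J) Z.* D Z.- (Z.+ 1 Z.+ nc Z.* k Z.* Z.+ 1)
                 ≡ k Z.* (L Z.* D Z.- (Z.+ 1 Z.+ nc)) Z.+ (k Z.- (Z.+ 1 Z.+ J Z.* D))
    identity = ZS.solve-∀
    crossMultiplied : nc Z.* + 1 Z.< + L Z.* D' → nc Z.* + k Z.* + 1 Z.< Δ Z.* + (suc D * 1)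
    crossMultiplied nc<LD = ZP.suc[i]≤j⇒i<j (≤-byDiff _ _ _ diff (+≥0 (*≥0 (pos≥0 k) (diff≥0 nc<LD')) (diff≥0 Jd<k')))
      where
        nc<LD' : Z.+ 1 Z.+ nc Z.≤ + L Z.* D'
        nc<LD' = subst (λ z → Z.+ 1 Z.+ z Z.≤ + L Z.* D') (ZP.*-identityʳ nc) (ZP.i<j⇒suc[i]≤j nc<LD)
        Jd<k' : Z.+ 1 Z.+ + J Z.* D' Z.≤ + k
        Jd<k' = subst (λ z → Z.+ 1 Z.+ z Z.≤ + k) (ZP.pos-* J (suc D)) (+≤+ Jd<k)
        diff : Δ Z.* + (suc D * 1) Z.- (Z.+ 1 Z.+ nc Z.* + k Z.* + 1)
                 ≡ + k Z.* (+ L Z.* D' Z.- (Z.+ 1 Z.+ nc)) Z.+ (+ k Z.- (Z.+ 1 Z.+ + J Z.* D'))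
        diff = trans (cong₂ (λ x y → x Z.* y Z.- (Z.+ 1 Z.+ nc Z.* + k Z.* + 1)) Δ≡ (cong +_ (*-identityʳ (suc D))))
                     (identity nc (+ L) (+ k) (+ J) D')
    unnormalised : (toℚᵘ c U.* mkℚᵘ (+ k) 0) U.< mkℚᵘ Δ 0
    unnormalised with c<Lᵘ
    ... | *<* h = *<* (crossMultiplied h)

module FiniteSums where

  Σℕ : ℕ → (ℕ → ℕ) → ℕ
  Σℕ zero    f = 0
  Σℕ (suc n) f = Σℕ n f + f n

  Σℕ-ext : ∀ n f g → (∀ v → v < n → f v ≡ g v) → Σℕ n f ≡ Σℕ n g
  Σℕ-ext zero    f g f≗g = refl
  Σℕ-ext (suc n) f g f≗g =
    cong₂ _+_ (Σℕ-ext n f g (λ v v<n → f≗g v (≤-trans v<n (n≤1+n n)))) (f≗g n ≤-refl)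

  Σℕ-exceptAt : ∀ n f g u → u < n → (∀ v → v < n → v ≢ u → f v ≡ g v) →
    Σℕ n f + g u ≡ Σℕ n g + f u
  Σℕ-exceptAt (suc n) f g u u<1+n f≗g with m≤n⇒m<n∨m≡n (≤-pred u<1+n)
  ... | inj₂ refl =
    trans (cong (λ x → x + f u + g u) (Σℕ-ext n f g (λ v v<n → f≗g v (≤-trans v<n (n≤1+n n)) (λ e → <-irrefl e v<n))))
          (swap (Σℕ n g) (f u) (g u))
    where swap : ∀ A x y → A + x + y ≡ A + y + x
          swap = solve-∀
  ... | inj₁ u<n = begin
      Σℕ n f + f n + g u ≡⟨ swap (Σℕ n f) (f n) (g u) ⟩
      Σℕ n f + g u + f n ≡⟨ cong (_+ f n) (Σℕ-exceptAt n f g u u<n (λ v v<n → f≗g v (≤-trans v<n (n≤1+n n)))) ⟩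
      Σℕ n g + f u + f n ≡⟨ cong (λ z → Σℕ n g + f u + z) (f≗g n ≤-refl (λ e → <-irrefl (sym e) u<n)) ⟩
      Σℕ n g + f u + g n ≡⟨ swap (Σℕ n g) (f u) (g n) ⟩
      Σℕ n g + g n + f u ∎
    where open ≡-Reasoning
          swap : ∀ A x y → A + x + y ≡ A + y + x
          swap = solve-∀

  Σℕ-split : ∀ m n f → Σℕ (m + n) f ≡ Σℕ m f + Σℕ n (λ i → f (m + i))
  Σℕ-split m zero    f = trans (cong (λ z → Σℕ z f) (+-identityʳ m)) (sym (+-identityʳ _))
  Σℕ-split m (suc n) f = begin
      Σℕ (m + suc n) f                               ≡⟨ cong (λ z → Σℕ z f) (+-suc m n) ⟩
      Σℕ (m + n) f + f (m + n)                       ≡⟨ cong (_+ f (m + n)) (Σℕ-split m n f) ⟩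
      Σℕ m f + Σℕ n (λ i → f (m + i)) + f (m + n)    ≡⟨ +-assoc (Σℕ m f) _ _ ⟩
      Σℕ m f + (Σℕ n (λ i → f (m + i)) + f (m + n))  ∎
    where open ≡-Reasoning

  Σℕ-+ : ∀ n f g → Σℕ n (λ v → f v + g v) ≡ Σℕ n f + Σℕ n g
  Σℕ-+ zero    f g = refl
  Σℕ-+ (suc n) f g = trans (cong (_+ (f n + g n)) (Σℕ-+ n f g)) (regroup (Σℕ n f) (Σℕ n g) (f n) (g n))
    where regroup : ∀ A B x y → A + B + (x + y) ≡ A + x + (B + y)
          regroup = solve-∀

  Σℕ-const : ∀ n k → Σℕ n (λ _ → k) ≡ n * k
  Σℕ-const zero    k = refl
  Σℕ-const (suc n) k = trans (cong (_+ k) (Σℕ-const n k)) (+-comm (n * k) k)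

  Σℤ : ℕ → (ℕ → ℤ) → ℤ
  Σℤ zero    f = + 0
  Σℤ (suc n) f = Σℤ n f Z.+ f n

  Σℤ-ext : ∀ n f g → (∀ v → v < n → f v ≡ g v) → Σℤ n f ≡ Σℤ n g
  Σℤ-ext zero    f g f≗g = refl
  Σℤ-ext (suc n) f g f≗g =
    cong₂ Z._+_ (Σℤ-ext n f g (λ v v<n → f≗g v (≤-trans v<n (n≤1+n n)))) (f≗g n ≤-refl)

  Σℤ-mono : ∀ n f g → (∀ v → v < n → f v Z.≤ g v) → Σℤ n f Z.≤ Σℤ n g
  Σℤ-mono zero    f g f≤g = ZP.≤-refl
  Σℤ-mono (suc n) f g f≤g = ZP.+-mono-≤ (Σℤ-mono n f g (λ v v<n → f≤g v (≤-trans v<n (n≤1+n n)))) (f≤g n ≤-refl)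

  Σℤ-pos : ∀ n f → + Σℕ n f ≡ Σℤ n (λ v → + f v)
  Σℤ-pos zero    f = refl
  Σℤ-pos (suc n) f = trans (ZP.pos-+ (Σℕ n f) (f n)) (cong (Z._+ + f n) (Σℤ-pos n f))

  Σℤ-+ : ∀ n f g → Σℤ n (λ v → f v Z.+ g v) ≡ Σℤ n f Z.+ Σℤ n g
  Σℤ-+ zero    f g = refl
  Σℤ-+ (suc n) f g = trans (cong (Z._+ (f n Z.+ g n)) (Σℤ-+ n f g)) (regroup (Σℤ n f) (Σℤ n g) (f n) (g n))
    where regroup : ∀ A B x y → A Z.+ B Z.+ (x Z.+ y) ≡ A Z.+ x Z.+ (B Z.+ y)
          regroup = ZS.solve-∀

  Σℤ-neg : ∀ n f → Σℤ n (λ v → - f v) ≡ - Σℤ n f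
  Σℤ-neg zero    f = refl
  Σℤ-neg (suc n) f = trans (cong (Z._+ (- f n)) (Σℤ-neg n f)) (sym (ZP.neg-distrib-+ (Σℤ n f) (f n)))

  Σℤ-scale : ∀ n k f → Σℤ n (λ v → k Z.* f v) ≡ k Z.* Σℤ n f
  Σℤ-scale zero    k f = sym (ZP.*-zeroʳ k)
  Σℤ-scale (suc n) k f = trans (cong (Z._+ (k Z.* f n)) (Σℤ-scale n k f)) (sym (ZP.*-distribˡ-+ k (Σℤ n f) (f n)))

  Σℤ-const : ∀ n k → Σℤ n (λ _ → k) ≡ + n Z.* k
  Σℤ-const zero    k = sym (ZP.*-zeroˡ k)
  Σℤ-const (suc n) k = trans (cong (Z._+ k) (Σℤ-const n k)) (regroup (+ n) k)
    where regroup : ∀ n k → n Z.* k Z.+ k ≡ (Z.+ 1 Z.+ n) Z.* k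
          regroup = ZS.solve-∀

  Σℤ-alternating : ∀ n f g k l →
    Σℤ n f Z.- Σℤ n g Z.- Σℤ n k Z.+ Σℤ n l ≡ Σℤ n (λ v → f v Z.- g v Z.- k v Z.+ l v)
  Σℤ-alternating n f g k l = sym (begin
      Σℤ n (λ v → f v Z.- g v Z.- k v Z.+ l v)                          ≡⟨ Σℤ-+ n _ l ⟩
      Σℤ n (λ v → f v Z.- g v Z.- k v) Z.+ Σℤ n l                       ≡⟨ cong (Z._+ Σℤ n l) (Σℤ-+ n _ _) ⟩
      Σℤ n (λ v → f v Z.- g v) Z.+ Σℤ n (λ v → - k v) Z.+ Σℤ n l        ≡⟨ cong (λ z → z Z.+ Σℤ n (λ v → - k v) Z.+ Σℤ n l) (Σℤ-+ n _ _) ⟩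
      Σℤ n f Z.+ Σℤ n (λ v → - g v) Z.+ Σℤ n (λ v → - k v) Z.+ Σℤ n l  ≡⟨ cong₂ (λ x y → Σℤ n f Z.+ x Z.+ y Z.+ Σℤ n l) (Σℤ-neg n g) (Σℤ-neg n k) ⟩
      Σℤ n f Z.- Σℤ n g Z.- Σℤ n k Z.+ Σℤ n l                           ∎)
    where open ≡-Reasoning

  Σℤ-linear : ∀ n K A B C f g k →
    Σℤ n (λ v → K Z.+ A Z.* f v Z.+ B Z.* g v Z.+ C Z.* k v)
      ≡ + n Z.* K Z.+ A Z.* Σℤ n f Z.+ B Z.* Σℤ n g Z.+ C Z.* Σℤ n k
  Σℤ-linear zero K A B C f g k = identity K A B C
    where identity : ∀ K A B C → Z.+ 0 ≡ Z.+ 0 Z.* K Z.+ A Z.* Z.+ 0 Z.+ B Z.* Z.+ 0 Z.+ C Z.* Z.+ 0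
          identity = ZS.solve-∀
  Σℤ-linear (suc n) K A B C f g k =
    trans (cong (Z._+ (K Z.+ A Z.* f n Z.+ B Z.* g n Z.+ C Z.* k n)) (Σℤ-linear n K A B C f g k))
          (identity (+ n) K A B C (Σℤ n f) (Σℤ n g) (Σℤ n k) (f n) (g n) (k n))
    where identity : ∀ n K A B C F G H fn gn hn →
                       (n Z.* K Z.+ A Z.* F Z.+ B Z.* G Z.+ C Z.* H) Z.+ (K Z.+ A Z.* fn Z.+ B Z.* gn Z.+ C Z.* hn)
                       ≡ (Z.+ 1 Z.+ n) Z.* K Z.+ A Z.* (F Z.+ fn) Z.+ B Z.* (G Z.+ gn) Z.+ C Z.* (H Z.+ hn)
          identity = ZS.solve-∀

open FiniteSums

module Digits (b : ℕ) .{{_ : NonZero b}} (b≥2 : 2 ≤ b) where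

  0<b : 0 < b
  0<b = ≤-trans (s≤s z≤n) b≥2

  euclid : ∀ X → X ≡ X % b + X / b * b
  euclid X = m≡m%n+[m/n]*n X b

  rem<b : ∀ X → X % b < b
  rem<b X = m%n<n X b

  quot-digit : ∀ r q → r < b → (r + q * b) / b ≡ q
  quot-digit r q r<b = begin
      (r + q * b) / b    ≡⟨ +-distrib-/-∣ʳ r (divides-refl q) ⟩
      r / b + q * b / b  ≡⟨ cong₂ _+_ (m<n⇒m/n≡0 r<b) (m*n/n≡m q b) ⟩
      q                  ∎
    where open ≡-Reasoning

  rem-digit : ∀ r q → r < b → (r + q * b) % b ≡ r
  rem-digit r q r<b = trans ([m+kn]%n≡m%n r q b) (m<n⇒m%n≡m r<b)

  quot-shift : ∀ Z H → (Z + H * b) / b ≡ Z / b + H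
  quot-shift Z H = trans (+-distrib-/-∣ʳ Z (divides-refl H)) (cong (λ z → Z / b + z) (m*n/n≡m H b))

  digitSumAux-zero : ∀ f → digitSumAux b f 0 ≡ 0
  digitSumAux-zero zero    = refl
  digitSumAux-zero (suc f) rewrite rem-digit 0 0 0<b | quot-digit 0 0 0<b = digitSumAux-zero f

  digitSumAux-fuel : ∀ f g n → n ≤ f → n ≤ g → digitSumAux b f n ≡ digitSumAux b g n
  digitSumAux-fuel f g zero _ _ = trans (digitSumAux-zero f) (sym (digitSumAux-zero g))
  digitSumAux-fuel (suc f) (suc g) (suc n) (s≤s n≤f) (s≤s n≤g) =
    cong (λ z → suc n % b + z) (digitSumAux-fuel f g (suc n / b) (≤-trans n/b≤n n≤f) (≤-trans n/b≤n n≤g))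
    where n/b≤n : suc n / b ≤ n
          n/b≤n = ≤-pred (m/n<m (suc n) b b≥2)

  s-step : ∀ n → s b n ≡ n % b + s b (n / b)
  s-step zero rewrite rem-digit 0 0 0<b | quot-digit 0 0 0<b = refl
  s-step (suc n) = cong (λ z → suc n % b + z)
    (digitSumAux-fuel n (suc n / b) (suc n / b) (≤-pred (m/n<m (suc n) b b≥2)) ≤-refl)

  s-digit : ∀ r q → r < b → s b (r + q * b) ≡ r + s b q
  s-digit r q r<b rewrite s-step (r + q * b) | rem-digit r q r<b | quot-digit r q r<b = refl

  -- adding 1 raises the digit sum by at most 1 (a carry only lowers it)
  s-suc≤ : ∀ x → s b (suc x) ≤ suc (s b x)
  s-suc≤ = <-rec P step
    where
      P : ℕ → Set
      P x = s b (suc x) ≤ suc (s b x)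
      byDigits : ∀ r q → r < b → (∀ {y} → y < r + q * b → P y) → P (r + q * b)
      byDigits r q r<b rec with m≤n⇒m<n∨m≡n r<b
      ... | inj₁ r+1<b = ≤-reflexive (trans (s-digit (suc r) q r+1<b) (cong suc (sym (s-digit r q r<b))))
      ... | inj₂ r+1≡b = begin
          s b (suc r + q * b)  ≡⟨ cong (λ z → s b (z + q * b)) r+1≡b ⟩
          s b (0 + suc q * b)  ≡⟨ s-digit 0 (suc q) 0<b ⟩
          s b (suc q)          ≤⟨ rec q<x ⟩
          suc (s b q)          ≤⟨ s≤s (m≤n+m (s b q) r) ⟩
          suc (r + s b q)      ≡⟨ cong suc (sym (s-digit r q r<b)) ⟩
          suc (s b (r + q * b)) ∎
        where
          open ≤-Reasoning
          q<x : q < r + q * b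
          q<x = begin-strict
            q          <⟨ m<n+m q (≤-pred (subst (2 ≤_) (sym r+1≡b) b≥2)) ⟩
            r + q      ≤⟨ +-monoʳ-≤ r (m≤m*n q b) ⟩
            r + q * b  ∎
      step : ∀ x → (∀ {y} → y < x → P y) → P x
      step x rec = subst P (sym (euclid x))
        (byDigits (x % b) (x / b) (rem<b x) (λ {y} y< → rec (subst (y <_) (sym (euclid x)) y<)))

  -- c_v(X) = #{n < X : n % b = v} = ⌈(X - v)/b⌉
  count : ℕ → ℕ → ℕ
  count v X = (X + (b ∸ suc v)) / b

  count-below : ∀ v r q → v < r → r < b → count v (r + q * b) ≡ suc q
  count-below v r q v<r r<b = begin
      (r + q * b + (b ∸ suc v)) / b          ≡⟨ cong (λ z → (z + q * b + (b ∸ suc v)) / b) (sym (m+[n∸m]≡n v<r)) ⟩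
      (suc v + d + q * b + (b ∸ suc v)) / b  ≡⟨ cong (_/ b) (regroup v d (b ∸ suc v) q b) ⟩
      (d + (suc v + (b ∸ suc v)) + q * b) / b ≡⟨ cong (λ z → (d + z + q * b) / b) (m+[n∸m]≡n (≤-trans v<r (<⇒≤ r<b))) ⟩
      (d + b + q * b) / b                    ≡⟨ cong (_/ b) (+-assoc d b (q * b)) ⟩
      (d + suc q * b) / b                    ≡⟨ quot-digit d (suc q) (≤-<-trans (m∸n≤m r (suc v)) r<b) ⟩
      suc q                                  ∎
    where
      open ≡-Reasoning
      d = r ∸ suc v
      regroup : ∀ v d e q B → (suc v + d) + q * B + e ≡ d + (suc v + e) + q * B
      regroup = solve-∀

  count-atLeast : ∀ v r q → r ≤ v → v < b → count v (r + q * b) ≡ q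
  count-atLeast v r q r≤v v<b = begin
      (r + q * b + e) / b   ≡⟨ cong (_/ b) (regroup r (q * b) e) ⟩
      ((r + e) + q * b) / b ≡⟨ quot-digit (r + e) q r+e<b ⟩
      q                     ∎
    where
      e = b ∸ suc v
      regroup : ∀ r Q e → r + Q + e ≡ (r + e) + Q
      regroup = solve-∀
      r+e<b : r + e < b
      r+e<b = begin-strict
        r + e      ≤⟨ +-monoˡ-≤ e r≤v ⟩
        v + e      <⟨ n<1+n (v + e) ⟩
        suc v + e  ≡⟨ m+[n∸m]≡n v<b ⟩
        b          ∎
        where open ≤-Reasoning
      open ≡-Reasoning

  count-zero : ∀ v → v < b → count v 0 ≡ 0
  count-zero v v<b = count-atLeast v 0 0 z≤n v<b

  count-own : ∀ X → count (X % b) X ≡ X / b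
  count-own X = subst (λ Y → count (X % b) Y ≡ X / b) (sym (euclid X))
                  (count-atLeast (X % b) (X % b) (X / b) ≤-refl (rem<b X))

  count-own-suc : ∀ X → count (X % b) (suc X) ≡ suc (X / b)
  count-own-suc X = subst (λ Y → count (X % b) (suc Y) ≡ suc (X / b)) (sym (euclid X))
                      (byDigits (X % b) (X / b) (rem<b X))
    where
      byDigits : ∀ r q → r < b → count r (suc (r + q * b)) ≡ suc q
      byDigits r q r<b with m≤n⇒m<n∨m≡n r<b
      ... | inj₁ r+1<b = count-below r (suc r) q ≤-refl r+1<b
      ... | inj₂ r+1≡b = trans (cong (λ z → count r (z + q * b)) r+1≡b) (count-atLeast r 0 (suc q) z≤n r<b)

  count-other-suc : ∀ X v → v < b → v ≢ X % b → count v (suc X) ≡ count v X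
  count-other-suc X v v<b v≢r = subst (λ Y → count v (suc Y) ≡ count v Y) (sym (euclid X))
                                  (byDigits (X % b) (X / b) (rem<b X) v≢r)
    where
      byDigits : ∀ r q → r < b → v ≢ r → count v (suc (r + q * b)) ≡ count v (r + q * b)
      byDigits r q r<b v≢r with <-cmp v r
      ... | tri≈ _ v≡r _ = ⊥-elim (v≢r v≡r)
      ... | tri> _ _ r<v = trans (count-atLeast v (suc r) q r<v v<b) (sym (count-atLeast v r q (<⇒≤ r<v) v<b))
      ... | tri< v<r _ _ = trans afterStep (sym (count-below v r q v<r r<b))
        where afterStep : count v (suc (r + q * b)) ≡ suc q
              afterStep with m≤n⇒m<n∨m≡n r<b
              ... | inj₁ r+1<b = count-below v (suc r) q (≤-trans v<r (n≤1+n r)) r+1<b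
              ... | inj₂ r+1≡b = trans (cong (λ z → count v (z + q * b)) r+1≡b) (count-atLeast v 0 (suc q) z≤n v<b)

  Σcount : ∀ X → Σℕ b (λ v → count v X) ≡ X
  Σcount zero = trans (Σℕ-ext b _ (λ _ → 0) count-zero) (trans (Σℕ-const b 0) (*-zeroʳ b))
  Σcount (suc X) = +-cancelʳ-≡ (count u X) _ _ (begin
      Σℕ b (λ v → count v (suc X)) + count u X
        ≡⟨ Σℕ-exceptAt b (λ v → count v (suc X)) (λ v → count v X) u (rem<b X) (λ v v<b ne → count-other-suc X v v<b ne) ⟩
      Σℕ b (λ v → count v X) + count u (suc X)
        ≡⟨ cong₂ _+_ (Σcount X) (trans (count-own-suc X) (cong suc (sym (count-own X)))) ⟩
      X + suc (count u X)  ≡⟨ +-suc X (count u X) ⟩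
      suc X + count u X    ∎)
    where
      open ≡-Reasoning
      u = X % b

  -- S(X) = Σ_v ( v c_v(X) + S(c_v(X)) ): every n < X with last digit v is v + q b with q < c_v(X)
  S-byLastDigit : ∀ X → S b X ≡ Σℕ b (λ v → v * count v X + S b (count v X))
  S-byLastDigit zero = sym (trans (Σℕ-ext b _ (λ _ → 0) atZero) (trans (Σℕ-const b 0) (*-zeroʳ b)))
    where atZero : ∀ v → v < b → v * count v 0 + S b (count v 0) ≡ 0
          atZero v v<b rewrite count-zero v v<b = trans (+-identityʳ (v * 0)) (*-zeroʳ v)
  S-byLastDigit (suc X) = +-cancelʳ-≡ (g u) _ _ (begin
      S b X + s b X + g u          ≡⟨ cong (λ z → S b X + z + g u) (s-step X) ⟩
      S b X + (u + s b q) + g u    ≡⟨ regroup (S b X) (u + s b q) (g u) ⟩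
      S b X + (g u + (u + s b q))  ≡⟨ cong (λ z → S b X + (u * z + S b z + (u + s b q))) (count-own X) ⟩
      S b X + (u * q + S b q + (u + s b q))   ≡⟨ cong (λ z → S b X + z) (lastStep u q (S b q) (s b q)) ⟩
      S b X + (u * suc q + S b (suc q))       ≡⟨ cong₂ _+_ (S-byLastDigit X) (cong (λ z → u * z + S b z) (sym (count-own-suc X))) ⟩
      Σℕ b g + f u                 ≡⟨ sym (Σℕ-exceptAt b f g u (rem<b X) (λ v v<b ne → cong (λ z → v * z + S b z) (count-other-suc X v v<b ne))) ⟩
      Σℕ b f + g u                 ∎)
    where
      open ≡-Reasoning
      u = X % b
      q = X / b
      f g : ℕ → ℕ
      f v = v * count v (suc X) + S b (count v (suc X))
      g v = v * count v X + S b (count v X)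
      regroup : ∀ A x y → A + x + y ≡ A + (y + x)
      regroup = solve-∀
      lastStep : ∀ u q Sq sq → u * q + Sq + (u + sq) ≡ u * suc q + (Sq + sq)
      lastStep = solve-∀

  count-shift : ∀ X h v → v < b → count ((v + h) % b) (X + h) ≡ count v X + (v + h) / b
  count-shift X h v v<b = trans (cong (_/ b) numerators) (quot-shift (X + e) H)
    where
      open ≡-Reasoning
      v' = (v + h) % b
      H = (v + h) / b
      e = b ∸ suc v
      e' = b ∸ suc v'
      regroup₁ : ∀ X h e' v → X + h + e' + suc v ≡ X + (v + h) + suc e'
      regroup₁ = solve-∀
      regroup₂ : ∀ X v' HB e' → X + (v' + HB) + suc e' ≡ X + HB + (suc v' + e')
      regroup₂ = solve-∀
      regroup₃ : ∀ X e HB v → X + e + HB + suc v ≡ X + HB + (suc v + e)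
      regroup₃ = solve-∀
      numerators : X + h + e' ≡ X + e + H * b
      numerators = +-cancelʳ-≡ (suc v) _ _ (begin
        X + h + e' + suc v         ≡⟨ regroup₁ X h e' v ⟩
        X + (v + h) + suc e'       ≡⟨ cong (λ z → X + z + suc e') (euclid (v + h)) ⟩
        X + (v' + H * b) + suc e'  ≡⟨ regroup₂ X v' (H * b) e' ⟩
        X + H * b + (suc v' + e')  ≡⟨ cong (λ z → X + H * b + z) (m+[n∸m]≡n (rem<b (v + h))) ⟩
        X + H * b + b              ≡⟨ cong (λ z → X + H * b + z) (sym (m+[n∸m]≡n v<b)) ⟩
        X + H * b + (suc v + e)    ≡⟨ sym (regroup₃ X e (H * b) v) ⟩
        X + e + H * b + suc v      ∎)

  Σ-rotate : ∀ h f → Σℕ b (λ v → f ((v + h) % b)) ≡ Σℕ b f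
  Σ-rotate h f = begin
      Σℕ b (λ v → f ((v + h) % b))                              ≡⟨ cong (λ z → Σℕ z (λ v → f ((v + h) % b))) (sym bt) ⟩
      Σℕ ((b ∸ t) + t) (λ v → f ((v + h) % b))                  ≡⟨ Σℕ-split (b ∸ t) t _ ⟩
      Σℕ (b ∸ t) (λ v → f ((v + h) % b)) + Σℕ t (λ i → f ((b ∸ t + i + h) % b))
                                                                ≡⟨ cong₂ _+_ (Σℕ-ext (b ∸ t) _ _ lowPart) (Σℕ-ext t _ _ highPart) ⟩
      Σℕ (b ∸ t) (λ v → f (t + v)) + Σℕ t f                     ≡⟨ +-comm _ (Σℕ t f) ⟩
      Σℕ t f + Σℕ (b ∸ t) (λ v → f (t + v))                     ≡⟨ sym (Σℕ-split t (b ∸ t) f) ⟩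
      Σℕ (t + (b ∸ t)) f                                        ≡⟨ cong (λ z → Σℕ z f) (m+[n∸m]≡n (<⇒≤ (rem<b h))) ⟩
      Σℕ b f                                                    ∎
    where
      open ≡-Reasoning
      t = h % b
      bt : (b ∸ t) + t ≡ b
      bt = m∸n+n≡m (<⇒≤ (rem<b h))
      reduce : ∀ v → (v + h) % b ≡ (v + t) % b
      reduce v = begin
        (v + h) % b                ≡⟨ cong (λ z → (v + z) % b) (euclid h) ⟩
        (v + (t + h / b * b)) % b  ≡⟨ cong (_% b) (sym (+-assoc v t _)) ⟩
        (v + t + h / b * b) % b    ≡⟨ [m+kn]%n≡m%n (v + t) (h / b) b ⟩
        (v + t) % b                ∎
      lowPart : ∀ v → v < b ∸ t → f ((v + h) % b) ≡ f (t + v)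
      lowPart v v<b-t = cong f (trans (reduce v) (trans (m<n⇒m%n≡m v+t<b) (+-comm v t)))
        where v+t<b : v + t < b
              v+t<b = subst (v + t <_) bt (+-monoˡ-< t v<b-t)
      highPart : ∀ i → i < t → f ((b ∸ t + i + h) % b) ≡ f i
      highPart i i<t = cong f (begin
        (b ∸ t + i + h) % b  ≡⟨ reduce (b ∸ t + i) ⟩
        (b ∸ t + i + t) % b  ≡⟨ cong (_% b) (regroup (b ∸ t) i t) ⟩
        (b ∸ t + t + i) % b  ≡⟨ cong (λ z → (z + i) % b) bt ⟩
        (b + i) % b          ≡⟨ cong (_% b) (+-comm b i) ⟩
        (i + b) % b          ≡⟨ [m+n]%n≡m%n i b ⟩
        i % b                ≡⟨ m<n⇒m%n≡m (<-≤-trans i<t (<⇒≤ (rem<b h))) ⟩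
        i                    ∎)
        where regroup : ∀ x i t → x + i + t ≡ x + t + i
              regroup = solve-∀

module SecondDifference (b : ℕ) .{{_ : NonZero b}} (b≥2 : 2 ≤ b) where

  open Digits b b≥2

  T : ℕ → ℕ → ℕ → ℤ
  T a w h = + S b (a + w + h) Z.- + S b (a + h) Z.- + S b (a + w) Z.+ + S b a

  T-sym : ∀ a w h → T a w h ≡ T a h w
  T-sym a w h = trans (cong (λ z → + S b z Z.- + S b (a + h) Z.- + S b (a + w) Z.+ + S b a) (regroup a w h))
                      (swap (+ S b (a + h + w)) (+ S b (a + h)) (+ S b (a + w)) (+ S b a))
    where regroup : ∀ a w h → a + w + h ≡ a + h + w
          regroup = solve-∀
          swap : ∀ A B C D → A Z.- B Z.- C Z.+ D ≡ A Z.- C Z.- B Z.+ D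
          swap = ZS.solve-∀

  T-zero : ∀ a h → T a 0 h ≡ + 0
  T-zero a h = trans (cong₂ (λ u z → + S b (u + h) Z.- + S b (a + h) Z.- + S b z Z.+ + S b a) (+-identityʳ a) (+-identityʳ a))
                     (cancel (+ S b (a + h)) (+ S b a))
    where cancel : ∀ A D → A Z.- A Z.- D Z.+ D ≡ + 0
          cancel = ZS.solve-∀

  T-one : ∀ a h → T a 1 h ≡ + s b (a + h) Z.- + s b a
  T-one a h = begin
      T a 1 h  ≡⟨ cong₂ (λ u z → + S b u Z.- + S b (a + h) Z.- + S b z Z.+ + S b a) (regroup a h) (+-comm a 1) ⟩
      + S b (suc (a + h)) Z.- + S b (a + h) Z.- + S b (suc a) Z.+ + S b a
        ≡⟨ cong₂ (λ u z → u Z.- + S b (a + h) Z.- z Z.+ + S b a) (ZP.pos-+ (S b (a + h)) (s b (a + h))) (ZP.pos-+ (S b a) (s b a)) ⟩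
      (+ S b (a + h) Z.+ + s b (a + h)) Z.- + S b (a + h) Z.- (+ S b a Z.+ + s b a) Z.+ + S b a
        ≡⟨ cancel (+ S b (a + h)) (+ s b (a + h)) (+ S b a) (+ s b a) ⟩
      + s b (a + h) Z.- + s b a  ∎
    where
      open ≡-Reasoning
      regroup : ∀ a h → a + 1 + h ≡ suc (a + h)
      regroup = solve-∀
      cancel : ∀ A x D y → (A Z.+ x) Z.- A Z.- (D Z.+ y) Z.+ D ≡ x Z.- y
      cancel = ZS.solve-∀

  windowCount : ℕ → ℕ → ℕ → ℕ
  windowCount a w v = count v (a + w) ∸ count v a

  -- shifting by h sends residue v to shiftRem h v and raises its count by shiftQuot h v
  shiftQuot shiftRem : ℕ → ℕ → ℕ
  shiftQuot h v = (v + h) / b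
  shiftRem  h v = (v + h) % b

  count-window : ∀ v a w → count v (a + w) ≡ count v a + windowCount a w v
  count-window v a w = sym (m+[n∸m]≡n (/-monoˡ-≤ b (+-monoˡ-≤ (b ∸ suc v) (m≤m+n a w))))

  S-window : ∀ a w → S b (a + w) ≡ Σℕ b (λ v → v * (count v a + windowCount a w v) + S b (count v a + windowCount a w v))
  S-window a w = trans (S-byLastDigit (a + w)) (Σℕ-ext b _ _ (λ v _ → cong (λ z → v * z + S b z) (count-window v a w)))

  S-shift : ∀ X h → S b (X + h) ≡ Σℕ b (λ v → shiftRem h v * (count v X + shiftQuot h v) + S b (count v X + shiftQuot h v))
  S-shift X h = trans (S-byLastDigit (X + h)) (trans (sym (Σ-rotate h F))
                  (Σℕ-ext b _ _ (λ v v<b → cong (λ z → shiftRem h v * z + S b z) (count-shift X h v v<b))))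
    where F = λ u → u * count u (X + h) + S b (count u (X + h))

  S-window-shift : ∀ a w h → S b (a + w + h) ≡
    Σℕ b (λ v → shiftRem h v * (count v a + windowCount a w v + shiftQuot h v) + S b (count v a + windowCount a w v + shiftQuot h v))
  S-window-shift a w h = trans (S-shift (a + w) h)
    (Σℕ-ext b _ _ (λ v _ → cong (λ z → shiftRem h v * (z + shiftQuot h v) + S b (z + shiftQuot h v)) (count-window v a w)))

  T-byLastDigit : ∀ a w h → T a w h ≡ Σℤ b (λ v →
    + shiftRem h v Z.* + windowCount a w v Z.- + v Z.* + windowCount a w v
      Z.+ T (count v a) (windowCount a w v) (shiftQuot h v))
  T-byLastDigit a w h = begin
      T a w h
        ≡⟨ cong₂ (λ x y → + x Z.- + y Z.- + S b (a + w) Z.+ + S b a) (S-window-shift a w h) (S-shift a h) ⟩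
      + Σℕ b g₄ Z.- + Σℕ b g₃ Z.- + S b (a + w) Z.+ + S b a
        ≡⟨ cong₂ (λ x y → + Σℕ b g₄ Z.- + Σℕ b g₃ Z.- + x Z.+ + y) (S-window a w) (S-byLastDigit a) ⟩
      + Σℕ b g₄ Z.- + Σℕ b g₃ Z.- + Σℕ b g₂ Z.+ + Σℕ b g₁
        ≡⟨ cong₂ (λ x y → x Z.- y Z.- + Σℕ b g₂ Z.+ + Σℕ b g₁) (Σℤ-pos b g₄) (Σℤ-pos b g₃) ⟩
      Σℤ b (λ v → + g₄ v) Z.- Σℤ b (λ v → + g₃ v) Z.- + Σℕ b g₂ Z.+ + Σℕ b g₁
        ≡⟨ cong₂ (λ x y → Σℤ b (λ v → + g₄ v) Z.- Σℤ b (λ v → + g₃ v) Z.- x Z.+ y) (Σℤ-pos b g₂) (Σℤ-pos b g₁) ⟩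
      Σℤ b (λ v → + g₄ v) Z.- Σℤ b (λ v → + g₃ v) Z.- Σℤ b (λ v → + g₂ v) Z.+ Σℤ b (λ v → + g₁ v)
        ≡⟨ Σℤ-alternating b _ _ _ _ ⟩
      Σℤ b (λ v → + g₄ v Z.- + g₃ v Z.- + g₂ v Z.+ + g₁ v)
        ≡⟨ Σℤ-ext b _ _ (λ v _ → pointwise v) ⟩
      Σℤ b (λ v → + shiftRem h v Z.* + windowCount a w v Z.- + v Z.* + windowCount a w v
                    Z.+ T (count v a) (windowCount a w v) (shiftQuot h v)) ∎
    where
      open ≡-Reasoning
      g₄ g₃ g₂ g₁ : ℕ → ℕ
      g₄ v = shiftRem h v * (count v a + windowCount a w v + shiftQuot h v) + S b (count v a + windowCount a w v + shiftQuot h v)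
      g₃ v = shiftRem h v * (count v a + shiftQuot h v) + S b (count v a + shiftQuot h v)
      g₂ v = v * (count v a + windowCount a w v) + S b (count v a + windowCount a w v)
      g₁ v = v * count v a + S b (count v a)
      pos-*+ : ∀ u x y → + (u * (x + y)) ≡ + u Z.* (+ x Z.+ + y)
      pos-*+ u x y = trans (ZP.pos-* u (x + y)) (cong (+ u Z.*_) (ZP.pos-+ x y))
      pos-*++ : ∀ u x y z → + (u * (x + y + z)) ≡ + u Z.* (+ x Z.+ + y Z.+ + z)
      pos-*++ u x y z = trans (ZP.pos-* u (x + y + z)) (cong (+ u Z.*_) (trans (ZP.pos-+ (x + y) z) (cong (Z._+ + z) (ZP.pos-+ x y))))
      identity : ∀ u v p W H A B C D →
        (u Z.* (p Z.+ W Z.+ H) Z.+ A) Z.- (u Z.* (p Z.+ H) Z.+ B) Z.- (v Z.* (p Z.+ W) Z.+ C) Z.+ (v Z.* p Z.+ D)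
          ≡ u Z.* W Z.- v Z.* W Z.+ (A Z.- B Z.- C Z.+ D)
      identity = ZS.solve-∀
      pointwise : ∀ v → + g₄ v Z.- + g₃ v Z.- + g₂ v Z.+ + g₁ v
        ≡ + shiftRem h v Z.* + windowCount a w v Z.- + v Z.* + windowCount a w v Z.+ T (count v a) (windowCount a w v) (shiftQuot h v)
      pointwise v = trans (cong₂ (λ x y → x Z.- y Z.- + g₂ v Z.+ + g₁ v) e₄ e₃)
                   (trans (cong₂ (λ x y → (+ u Z.* (+ p Z.+ + W Z.+ + H) Z.+ + S b (p + W + H)) Z.- (+ u Z.* (+ p Z.+ + H) Z.+ + S b (p + H)) Z.- x Z.+ y) e₂ e₁)
                          (identity (+ u) (+ v) (+ p) (+ W) (+ H) (+ S b (p + W + H)) (+ S b (p + H)) (+ S b (p + W)) (+ S b p)))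
        where
          u = shiftRem h v
          p = count v a
          W = windowCount a w v
          H = shiftQuot h v
          e₄ : + g₄ v ≡ + u Z.* (+ p Z.+ + W Z.+ + H) Z.+ + S b (p + W + H)
          e₄ = trans (ZP.pos-+ (u * (p + W + H)) (S b (p + W + H))) (cong (Z._+ + S b (p + W + H)) (pos-*++ u p W H))
          e₃ : + g₃ v ≡ + u Z.* (+ p Z.+ + H) Z.+ + S b (p + H)
          e₃ = trans (ZP.pos-+ (u * (p + H)) (S b (p + H))) (cong (Z._+ + S b (p + H)) (pos-*+ u p H))
          e₂ : + g₂ v ≡ + v Z.* (+ p Z.+ + W) Z.+ + S b (p + W)
          e₂ = trans (ZP.pos-+ (v * (p + W)) (S b (p + W))) (cong (Z._+ + S b (p + W)) (pos-*+ v p W))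
          e₁ : + g₁ v ≡ + v Z.* + p Z.+ + S b p
          e₁ = trans (ZP.pos-+ (v * p) (S b p)) (cong (Z._+ + S b p) (ZP.pos-* v p))

  Σwindow : ∀ a w → Σℕ b (windowCount a w) ≡ w
  Σwindow a w = +-cancelˡ-≡ a _ _ (begin
      a + Σℕ b (windowCount a w)                             ≡⟨ cong (_+ Σℕ b (windowCount a w)) (sym (Σcount a)) ⟩
      Σℕ b (λ v → count v a) + Σℕ b (windowCount a w)        ≡⟨ sym (Σℕ-+ b _ _) ⟩
      Σℕ b (λ v → count v a + windowCount a w v)             ≡⟨ Σℕ-ext b _ _ (λ v _ → sym (count-window v a w)) ⟩
      Σℕ b (λ v → count v (a + w))                           ≡⟨ Σcount (a + w) ⟩
      a + w                                                  ∎)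
    where open ≡-Reasoning

  ΣshiftQuot : ∀ h → Σℕ b (shiftQuot h) ≡ h
  ΣshiftQuot h = begin
      Σℕ b (shiftQuot h)                        ≡⟨ Σℕ-ext b _ _ (λ v v<b → sym (trans (count-shift 0 h v v<b) (cong (_+ shiftQuot h v) (count-zero v v<b)))) ⟩
      Σℕ b (λ v → count (shiftRem h v) (0 + h)) ≡⟨ Σ-rotate h (λ u → count u h) ⟩
      Σℕ b (λ u → count u h)                    ≡⟨ Σcount h ⟩
      h                                         ∎
    where open ≡-Reasoning

  -- For a shift w = t + p b, each residue occurs p + α_v times in a window of length w, and
  -- a shift h = t' + p b raises the count of each residue by p + β_v, with α_v, β_v ∈ {0,1}.
  α : ℕ → ℕ → ℕ → ℕ
  α a t v = (a + (b ∸ suc v) + t) / b ∸ (a + (b ∸ suc v)) / b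

  β : ℕ → ℕ → ℕ
  β t v = (v + t) / b

  windowCount-digits : ∀ a w t p v → w ≡ t + p * b → windowCount a w v ≡ p + α a t v
  windowCount-digits a .(t + p * b) t p v refl = begin
      count v (a + (t + p * b)) ∸ count v a  ≡⟨ cong (_∸ count v a) (trans (cong (_/ b) (regroup a e t p b)) (quot-shift (Y + t) p)) ⟩
      ((Y + t) / b + p) ∸ Y / b              ≡⟨ +-∸-comm p (/-monoˡ-≤ b (m≤m+n Y t)) ⟩
      ((Y + t) / b ∸ Y / b) + p              ≡⟨ +-comm _ p ⟩
      p + α a t v                            ∎
    where
      open ≡-Reasoning
      e = b ∸ suc v
      Y = a + e
      regroup : ∀ a e t p B → a + (t + p * B) + e ≡ (a + e + t) + p * B
      regroup = solve-∀

  α≤1 : ∀ a t v → t ≤ b → α a t v ≤ 1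
  α≤1 a t v t≤b = begin
      (Y + t) / b ∸ Y / b      ≤⟨ ∸-monoˡ-≤ (Y / b) (/-monoˡ-≤ b (+-monoʳ-≤ Y t≤b)) ⟩
      (Y + b) / b ∸ Y / b      ≡⟨ cong (λ x → (Y + x) / b ∸ Y / b) (sym (+-identityʳ b)) ⟩
      (Y + 1 * b) / b ∸ Y / b  ≡⟨ cong (_∸ Y / b) (quot-shift Y 1) ⟩
      Y / b + 1 ∸ Y / b        ≡⟨ m+n∸m≡n (Y / b) 1 ⟩
      1                        ∎
    where open ≤-Reasoning
          Y = a + (b ∸ suc v)

  α-zero : ∀ a v → α a 0 v ≡ 0
  α-zero a v = trans (cong (λ x → x / b ∸ Y / b) (+-identityʳ Y)) (n∸n≡0 (Y / b))
    where Y = a + (b ∸ suc v)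

  shiftQuot-digits : ∀ h t p v → h ≡ t + p * b → shiftQuot h v ≡ p + β t v
  shiftQuot-digits .(t + p * b) t p v refl =
    trans (cong (_/ b) (sym (+-assoc v t (p * b)))) (trans (quot-shift (v + t) p) (+-comm _ p))

  β≤1 : ∀ t v → t < b → v < b → β t v ≤ 1
  β≤1 t v t<b v<b = ≤-pred (m<n*o⇒m/o<n (begin-strict
      v + t  <⟨ +-mono-< v<b t<b ⟩
      b + b  ≡⟨ cong (λ z → b + z) (sym (+-identityʳ b)) ⟩
      2 * b  ∎))
    where open ≤-Reasoning

  β-zero : ∀ v → v < b → β 0 v ≡ 0
  β-zero v v<b = trans (cong (_/ b) (+-identityʳ v)) (m<n⇒m/n≡0 v<b)

  Σ-dropQuotient : ∀ f g p t → (∀ v → v < b → f v ≡ p + g v) → Σℕ b f ≡ t + p * b → Σℕ b g ≡ t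
  Σ-dropQuotient f g p t f≗ Σf = +-cancelʳ-≡ (p * b) _ t (begin
      Σℕ b g + p * b          ≡⟨ cong (λ z → Σℕ b g + z) (trans (*-comm p b) (sym (Σℕ-const b p))) ⟩
      Σℕ b g + Σℕ b (λ _ → p) ≡⟨ +-comm (Σℕ b g) _ ⟩
      Σℕ b (λ _ → p) + Σℕ b g ≡⟨ sym (Σℕ-+ b _ _) ⟩
      Σℕ b (λ v → p + g v)    ≡⟨ sym (Σℕ-ext b _ _ f≗) ⟩
      Σℕ b f                  ≡⟨ Σf ⟩
      t + p * b               ∎)
    where open ≡-Reasoning

  Σα : ∀ a w t p → w ≡ t + p * b → Σℕ b (α a t) ≡ t
  Σα a w t p w≡ = Σ-dropQuotient (windowCount a w) (α a t) p t (λ v _ → windowCount-digits a w t p v w≡) (trans (Σwindow a w) w≡)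

  Σβ : ∀ h t p → h ≡ t + p * b → Σℕ b (β t) ≡ t
  Σβ h t p h≡ = Σ-dropQuotient (shiftQuot h) (β t) p t (λ v _ → shiftQuot-digits h t p v h≡) (trans (ΣshiftQuot h) h≡)

  shiftRem-minus : ∀ h v → + shiftRem h v Z.- + v ≡ + h Z.- + b Z.* + shiftQuot h v
  shiftRem-minus h v = solveFor (+ shiftRem h v) (+ v) (+ h) (+ shiftQuot h v) (+ b) division
    where
      division : + v Z.+ + h ≡ + shiftRem h v Z.+ + shiftQuot h v Z.* + b
      division = trans (sym (ZP.pos-+ v h)) (trans (cong +_ (euclid (v + h)))
                   (trans (ZP.pos-+ (shiftRem h v) _) (cong (λ z → + shiftRem h v Z.+ z) (ZP.pos-* (shiftQuot h v) b))))
      identity : ∀ u v h H B → (v Z.+ h) Z.- (u Z.+ H Z.* B) Z.+ (u Z.- v) ≡ h Z.- B Z.* H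
      identity = ZS.solve-∀
      cancel : ∀ x y → x Z.- x Z.+ y ≡ y
      cancel = ZS.solve-∀
      solveFor : ∀ u v h H B → v Z.+ h ≡ u Z.+ H Z.* B → u Z.- v ≡ h Z.- B Z.* H
      solveFor u v h H B eq =
        trans (sym (trans (cong (λ z → z Z.- (u Z.+ H Z.* B) Z.+ (u Z.- v)) eq) (cancel (u Z.+ H Z.* B) (u Z.- v))))
              (identity u v h H B)

  T-decomposition : ∀ a w h t p t' p' → w ≡ t + p * b → h ≡ t' + p' * b →
    T a w h ≡ Σℤ b (λ v → (+ t' Z.- + b Z.* + β t' v) Z.* (+ p Z.+ + α a t v)
                          Z.+ T (count v a) (p + α a t v) (p' + β t' v))
  T-decomposition a w h t p t' p' w≡ h≡ = trans (T-byLastDigit a w h) (Σℤ-ext b _ _ pointwise)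
    where
      open ≡-Reasoning
      factor : ∀ u v W T → u Z.* W Z.- v Z.* W Z.+ T ≡ (u Z.- v) Z.* W Z.+ T
      factor = ZS.solve-∀
      collect : ∀ t' p' B β → t' Z.+ p' Z.* B Z.- B Z.* (p' Z.+ β) ≡ t' Z.- B Z.* β
      collect = ZS.solve-∀
      pointwise : ∀ v → v < b → _
      pointwise v _ = begin
        + shiftRem h v Z.* + W Z.- + v Z.* + W Z.+ T (count v a) W H
          ≡⟨ factor (+ shiftRem h v) (+ v) (+ W) _ ⟩
        (+ shiftRem h v Z.- + v) Z.* + W Z.+ T (count v a) W H
          ≡⟨ cong (λ z → z Z.* + W Z.+ T (count v a) W H) (shiftRem-minus h v) ⟩
        (+ h Z.- + b Z.* + H) Z.* + W Z.+ T (count v a) W H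
          ≡⟨ cong₂ (λ x y → (+ h Z.- + b Z.* + y) Z.* + x Z.+ T (count v a) x y) (windowCount-digits a w t p v w≡) (shiftQuot-digits h t' p' v h≡) ⟩
        (+ h Z.- + b Z.* + (p' + β t' v)) Z.* + (p + α a t v) Z.+ T (count v a) (p + α a t v) (p' + β t' v)
          ≡⟨ cong₂ (λ x y → x Z.* y Z.+ T (count v a) (p + α a t v) (p' + β t' v)) h-part (ZP.pos-+ p (α a t v)) ⟩
        (+ t' Z.- + b Z.* + β t' v) Z.* (+ p Z.+ + α a t v) Z.+ T (count v a) (p + α a t v) (p' + β t' v) ∎
        where
          W = windowCount a w v
          H = shiftQuot h v
          h-part : + h Z.- + b Z.* + (p' + β t' v) ≡ + t' Z.- + b Z.* + β t' v
          h-part = begin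
            + h Z.- + b Z.* + (p' + β t' v)
              ≡⟨ cong₂ (λ x y → x Z.- + b Z.* y) (trans (cong +_ h≡) (trans (ZP.pos-+ t' (p' * b)) (cong (λ z → + t' Z.+ z) (ZP.pos-* p' b)))) (ZP.pos-+ p' (β t' v)) ⟩
            + t' Z.+ + p' Z.* + b Z.- + b Z.* (+ p' Z.+ + β t' v) ≡⟨ collect (+ t') (+ p') (+ b) (+ β t' v) ⟩
            + t' Z.- + b Z.* + β t' v ∎

module HalfConstant where

  L-step : ∀ n → L (suc (suc n)) ≡ suc (L n)
  L-step n = m/n≡1+[m∸n]/n {suc (suc n) + 1} {2} (s≤s (s≤s z≤n))

  halves : ∀ n → (Σ ℕ λ d → n ≡ d + d × L n ≡ d) ⊎ (Σ ℕ λ d → n ≡ suc (d + d) × L n ≡ suc d)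
  halves zero          = inj₁ (0 , refl , refl)
  halves (suc zero)    = inj₂ (0 , refl , refl)
  halves (suc (suc n)) with halves n
  ... | inj₁ (d , n≡ , Ln≡) = inj₁ (suc d , cong suc (trans (cong suc n≡) (sym (+-suc d d))) , trans (L-step n) (cong suc Ln≡))
  ... | inj₂ (d , n≡ , Ln≡) = inj₂ (suc d , cong suc (trans (cong suc n≡) (cong suc (sym (+-suc d d)))) , trans (L-step n) (cong suc Ln≡))

  L≤ : ∀ n → L n ≤ n
  L≤ n with halves n
  ... | inj₁ (d , refl , Ln≡) = subst (_≤ d + d) (sym Ln≡) (m≤m+n d d)
  ... | inj₂ (d , refl , Ln≡) = subst (_≤ suc (d + d)) (sym Ln≡) (s≤s (m≤m+n d d))

  ≤2L : ∀ n → n ≤ L n + L n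
  ≤2L n with halves n
  ... | inj₁ (d , refl , Ln≡) = subst (λ z → d + d ≤ z + z) (sym Ln≡) ≤-refl
  ... | inj₂ (d , refl , Ln≡) = subst (λ z → suc (d + d) ≤ z + z) (sym Ln≡) (s≤s (+-monoʳ-≤ d (n≤1+n d)))

  1≤L : ∀ n → 1 ≤ n → 1 ≤ L n
  1≤L n 1≤n with halves n
  ... | inj₁ (zero  , refl , _)   = ⊥-elim (<-irrefl refl 1≤n)
  ... | inj₁ (suc d , refl , Ln≡) = subst (1 ≤_) (sym Ln≡) (s≤s z≤n)
  ... | inj₂ (d     , refl , Ln≡) = subst (1 ≤_) (sym Ln≡) (s≤s z≤n)

  2≤L : ∀ n → 3 ≤ n → 2 ≤ L n
  2≤L (suc (suc n)) (s≤s (s≤s 1≤n)) = subst (2 ≤_) (sym (L-step n)) (s≤s (1≤L n 1≤n))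

  odd⇒2L≡1+ : ∀ n → n % 2 ≡ 1 → L n + L n ≡ suc n
  odd⇒2L≡1+ n odd with halves n
  ... | inj₂ (d , refl , Ln≡) = trans (cong₂ _+_ Ln≡ Ln≡) (cong suc (+-suc d d))
  ... | inj₁ (d , refl , _)   = ⊥-elim (0≢1+n (trans (sym (even d)) odd))
    where even : ∀ d → (d + d) % 2 ≡ 0
          even d = trans (cong (_% 2) (trans (cong (λ z → d + z) (sym (+-identityʳ d))) (*-comm 2 d))) (m*n%n≡0 d 2)

  odd⇒3≤ : ∀ n → 2 ≤ n → n % 2 ≡ 1 → 3 ≤ n
  odd⇒3≤ n 2≤n odd = ≤∧≢⇒< 2≤n (λ 2≡n → 0≢1+n (trans (cong (_% 2) 2≡n) odd))

open HalfConstant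

module UpperBound (b : ℕ) .{{_ : NonZero b}} (b≥2 : 2 ≤ b) where

  open Digits b b≥2
  open SecondDifference b b≥2

  -- two unit steps raise the digit sum by at most L: by at most 2 ≤ L when b ≥ 3, and for
  -- b = 2 the step x ↦ x + 2 leaves the last binary digit alone
  s-suc-suc≤ : ∀ x → s b (suc (suc x)) ≤ s b x + L b
  s-suc-suc≤ x with b ≟ 2
  ... | no b≢2 = begin
      s b (suc (suc x))  ≤⟨ s-suc≤ (suc x) ⟩
      suc (s b (suc x))  ≤⟨ s≤s (s-suc≤ x) ⟩
      suc (suc (s b x))  ≡⟨ +-comm 2 (s b x) ⟩
      s b x + 2          ≤⟨ +-monoʳ-≤ (s b x) (2≤L b (≤∧≢⇒< b≥2 (λ 2≡b → b≢2 (sym 2≡b)))) ⟩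
      s b x + L b        ∎
    where open ≤-Reasoning
  ... | yes b≡2 = begin
      s b (suc (suc x))            ≡⟨ cong (λ z → s b (suc (suc z))) (euclid x) ⟩
      s b (suc (suc (r + q * b)))  ≡⟨ cong (s b) plusTwo ⟩
      s b (r + suc q * b)          ≡⟨ s-digit r (suc q) (rem<b x) ⟩
      r + s b (suc q)              ≤⟨ +-monoʳ-≤ r (s-suc≤ q) ⟩
      r + suc (s b q)              ≡⟨ +-suc r (s b q) ⟩
      suc (r + s b q)              ≡⟨ cong suc (sym (s-digit r q (rem<b x))) ⟩
      suc (s b (r + q * b))        ≡⟨ cong (λ z → suc (s b z)) (sym (euclid x)) ⟩
      suc (s b x)                  ≡⟨ +-comm 1 (s b x) ⟩
      s b x + L 2                  ≡⟨ cong (λ z → s b x + L z) (sym b≡2) ⟩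
      s b x + L b                  ∎
    where
      open ≤-Reasoning
      r = x % b
      q = x / b
      plusTwo : suc (suc (r + q * b)) ≡ r + suc q * b
      plusTwo = trans (sym (trans (+-suc r (suc (q * b))) (cong suc (+-suc r (q * b)))))
                      (cong (λ z → r + (z + q * b)) (sym b≡2))

  T-one≤ : ∀ a h e → s b (a + h) + e ≤ s b a + L b → T a 1 h Z.+ + e Z.≤ + L b Z.* + 1
  T-one≤ a h e s≤ = subst₂ Z._≤_ (cong (Z._+ + e) (sym (T-one a h))) (sym (ZP.*-identityʳ (+ L b)))
    (≤-byDiff _ _ _ (identity (+ s b (a + h)) (+ s b a) (+ L b) (+ e))
      (diff≥0 (subst₂ Z._≤_ (ZP.pos-+ (s b (a + h)) e) (ZP.pos-+ (s b a) (L b)) (+≤+ s≤))))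
    where identity : ∀ x y l e → l Z.- (x Z.- y Z.+ e) ≡ (y Z.+ l) Z.- (x Z.+ e)
          identity = ZS.solve-∀

  Bounded : ℕ → Set
  Bounded w = ∀ a → (T a w w Z.≤ + L b Z.* + w) × (T a w (suc w) Z.≤ + L b Z.* + w)

  bounded-zero : Bounded 0
  bounded-zero a = byZero (T-zero a 0) , byZero (T-zero a 1)
    where byZero : ∀ {x} → x ≡ + 0 → x Z.≤ + L b Z.* + 0
          byZero x≡0 = ZP.≤-reflexive (trans x≡0 (sym (ZP.*-zeroʳ (+ L b))))

  bounded-one : Bounded 1
  bounded-one a = +0-≤ (T-one≤ a 1 0 (subst (_≤ s b a + L b) (sym (+-identityʳ _)) plusOne)) ,
                  +0-≤ (T-one≤ a 2 0 (subst (_≤ s b a + L b) (sym (+-identityʳ _)) plusTwo))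
    where
      plusOne : s b (a + 1) ≤ s b a + L b
      plusOne = subst (λ z → s b z ≤ s b a + L b) (+-comm 1 a)
        (≤-trans (s-suc≤ a) (subst (_≤ s b a + L b) (+-comm (s b a) 1) (+-monoʳ-≤ (s b a) (1≤L b (≤-trans (s≤s z≤n) b≥2)))))
      plusTwo : s b (a + 2) ≤ s b a + L b
      plusTwo = subst (λ z → s b z ≤ s b a + L b) (+-comm 2 a) (s-suc-suc≤ a)

  subBound : ∀ a p α β → α ≤ 1 → β ≤ 1 → Bounded p → (α ≡ 1 → β ≡ 1 → Bounded (suc p)) →
    T a (p + α) (p + β) Z.≤ + L b Z.* (+ p Z.+ + α Z.* + β)
  subBound a p zero    zero    _ _ bp _ rewrite +-identityʳ p = proj₁ (bp a)
  subBound a p (suc zero) zero _ _ bp _ rewrite +-identityʳ p | +-comm p 1 =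
    subst (Z._≤ + L b Z.* + p) (T-sym a p (suc p)) (proj₂ (bp a))
  subBound a p zero (suc zero) _ _ bp _ rewrite +-identityʳ p | +-comm p 1 = proj₂ (bp a)
  subBound a p (suc zero) (suc zero) _ _ _ bsp rewrite +-comm p 1 = proj₁ (bsp refl refl a)
  subBound a p (suc (suc _)) _ (s≤s ()) _ _ _
  subBound a p _ (suc (suc _)) _ (s≤s ()) _ _

  carryBound : ∀ a p α → α ≤ 1 → Bounded p → (α ≡ 1 → Bounded (suc p)) →
    T a (p + α) (suc p) Z.≤ + L b Z.* (+ p Z.+ + α)
  carryBound a p zero       _ bp _ rewrite +-identityʳ p = proj₂ (bp a)
  carryBound a p (suc zero) _ _ bsp rewrite +-comm p 1 = proj₁ (bsp refl a)
  carryBound a p (suc (suc _)) (s≤s ()) _ _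

  -- Γ = Σ_v α_v β_v, which by inclusion–exclusion is at least Σα + Σβ - b
  Γ : (ℕ → ℕ) → (ℕ → ℕ) → ℤ
  Γ α β = Σℤ b (λ v → + α v Z.* + β v)

  Γ≥0 : ∀ α β → + 0 Z.≤ Γ α β
  Γ≥0 α β = subst (Z._≤ Γ α β) (trans (Σℤ-const b (+ 0)) (ZP.*-zeroʳ (+ b)))
              (Σℤ-mono b _ _ (λ v _ → *≥0 (pos≥0 (α v)) (pos≥0 (β v))))

  Γ≥ : ∀ α β t t' → Σℕ b α ≡ t → Σℕ b β ≡ t' → (∀ v → v < b → α v ≤ 1) → (∀ v → v < b → β v ≤ 1) →
    + t Z.+ + t' Z.- + b Z.≤ Γ α β
  Γ≥ α β t t' Σα≡ Σβ≡ α≤1 β≤1 = subst (Z._≤ Γ α β) sum (Σℤ-mono b _ _ pointwise)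
    where
      pointwise : ∀ v → v < b → Z.- Z.+ 1 Z.+ Z.+ 1 Z.* + α v Z.+ Z.+ 1 Z.* + β v Z.+ Z.+ 0 Z.* + α v Z.≤ + α v Z.* + β v
      pointwise v v<b with α v | β v | α≤1 v v<b | β≤1 v v<b
      ... | zero     | zero     | _ | _ = Z.-≤+
      ... | zero     | suc zero | _ | _ = +≤+ z≤n
      ... | suc zero | zero     | _ | _ = +≤+ z≤n
      ... | suc zero | suc zero | _ | _ = +≤+ (s≤s z≤n)
      ... | suc (suc _) | _ | s≤s () | _
      ... | _ | suc (suc _) | _ | s≤s ()
      identity : ∀ b t t' → b Z.* (Z.- Z.+ 1) Z.+ Z.+ 1 Z.* t Z.+ Z.+ 1 Z.* t' Z.+ Z.+ 0 Z.* t ≡ t Z.+ t' Z.- b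
      identity = ZS.solve-∀
      sum : Σℤ b (λ v → Z.- Z.+ 1 Z.+ Z.+ 1 Z.* + α v Z.+ Z.+ 1 Z.* + β v Z.+ Z.+ 0 Z.* + α v) ≡ + t Z.+ + t' Z.- + b
      sum = begin
        _ ≡⟨ Σℤ-linear b (Z.- Z.+ 1) (Z.+ 1) (Z.+ 1) (Z.+ 0) (λ v → + α v) (λ v → + β v) (λ v → + α v) ⟩
        + b Z.* (Z.- Z.+ 1) Z.+ Z.+ 1 Z.* Σℤ b (λ v → + α v) Z.+ Z.+ 1 Z.* Σℤ b (λ v → + β v) Z.+ Z.+ 0 Z.* Σℤ b (λ v → + α v)
          ≡⟨ cong₂ (λ x y → + b Z.* (Z.- Z.+ 1) Z.+ Z.+ 1 Z.* x Z.+ Z.+ 1 Z.* y Z.+ Z.+ 0 Z.* x)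
               (trans (sym (Σℤ-pos b α)) (cong +_ Σα≡)) (trans (sym (Σℤ-pos b β)) (cong +_ Σβ≡)) ⟩
        + b Z.* (Z.- Z.+ 1) Z.+ Z.+ 1 Z.* + t Z.+ Z.+ 1 Z.* + t' Z.+ Z.+ 0 Z.* + t ≡⟨ identity (+ b) (+ t) (+ t') ⟩
        + t Z.+ + t' Z.- + b ∎
        where open ≡-Reasoning

  termBound : ℕ → ℕ → (ℕ → ℕ) → (ℕ → ℕ) → ℕ → ℤ
  termBound t' p α β v = (+ t' Z.- + b Z.* + β v) Z.* (+ p Z.+ + α v) Z.+ + L b Z.* (+ p Z.+ + α v Z.* + β v)

  collectTerms : ∀ (α β : ℕ → ℕ) t t' p w e → w ≡ t + p * b → Σℕ b α ≡ t → Σℕ b β ≡ t' →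
    + t Z.* + t' Z.+ e Z.≤ + L b Z.* + t Z.+ (+ b Z.- + L b) Z.* Γ α β →
    Σℤ b (termBound t' p α β) Z.+ e Z.≤ + L b Z.* + w
  collectTerms α β t t' p w e w≡ Σα≡ Σβ≡ finish = ≤-byDiff _ _ _ difference (diff≥0 finish)
    where
      K = + t' Z.* + p Z.+ + L b Z.* + p
      expand : ∀ t' B β p α L → (t' Z.- B Z.* β) Z.* (p Z.+ α) Z.+ L Z.* (p Z.+ α Z.* β)
                 ≡ (t' Z.* p Z.+ L Z.* p) Z.+ t' Z.* α Z.+ (Z.- (B Z.* p)) Z.* β Z.+ (L Z.- B) Z.* (α Z.* β)
      expand = ZS.solve-∀
      summed : Σℤ b (termBound t' p α β) ≡ + b Z.* K Z.+ + t' Z.* + t Z.+ (Z.- (+ b Z.* + p)) Z.* + t' Z.+ (+ L b Z.- + b) Z.* Γ α β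
      summed = begin
        Σℤ b (termBound t' p α β)
          ≡⟨ Σℤ-ext b _ _ (λ v _ → expand (+ t') (+ b) (+ β v) (+ p) (+ α v) (+ L b)) ⟩
        _ ≡⟨ Σℤ-linear b K (+ t') (Z.- (+ b Z.* + p)) (+ L b Z.- + b) (λ v → + α v) (λ v → + β v) (λ v → + α v Z.* + β v) ⟩
        + b Z.* K Z.+ + t' Z.* Σℤ b (λ v → + α v) Z.+ (Z.- (+ b Z.* + p)) Z.* Σℤ b (λ v → + β v) Z.+ (+ L b Z.- + b) Z.* Γ α β
          ≡⟨ cong₂ (λ x y → + b Z.* K Z.+ + t' Z.* x Z.+ (Z.- (+ b Z.* + p)) Z.* y Z.+ (+ L b Z.- + b) Z.* Γ α β)
               (trans (sym (Σℤ-pos b α)) (cong +_ Σα≡)) (trans (sym (Σℤ-pos b β)) (cong +_ Σβ≡)) ⟩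
        _ ∎
        where open ≡-Reasoning
      w≡ℤ : + w ≡ + t Z.+ + p Z.* + b
      w≡ℤ = trans (cong +_ w≡) (trans (ZP.pos-+ t (p * b)) (cong (λ z → + t Z.+ z) (ZP.pos-* p b)))
      identity : ∀ L t p b t' G e → L Z.* (t Z.+ p Z.* b) Z.- ((b Z.* (t' Z.* p Z.+ L Z.* p) Z.+ t' Z.* t Z.+ (Z.- (b Z.* p)) Z.* t' Z.+ (L Z.- b) Z.* G) Z.+ e)
                   ≡ L Z.* t Z.+ (b Z.- L) Z.* G Z.- (t Z.* t' Z.+ e)
      identity = ZS.solve-∀
      difference : + L b Z.* + w Z.- (Σℤ b (termBound t' p α β) Z.+ e) ≡ + L b Z.* + t Z.+ (+ b Z.- + L b) Z.* Γ α β Z.- (+ t Z.* + t' Z.+ e)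
      difference = trans (cong₂ (λ x y → + L b Z.* x Z.- (y Z.+ e)) w≡ℤ summed) (identity (+ L b) (+ t) (+ p) (+ b) (+ t') (Γ α β) e)

  quot< : ∀ w → 1 ≤ w → w / b < w
  quot< (suc w) _ = m/n<m (suc w) b b≥2

  quot+1< : ∀ w t p → w ≡ t + p * b → 2 ≤ w → 1 ≤ t → suc p < w
  quot+1< w t zero    w≡ 2≤w 1≤t = 2≤w
  quot+1< w t (suc p) w≡ 2≤w 1≤t = subst (suc (suc (suc p)) ≤_) (sym w≡) (begin
      suc (suc (suc p))      ≤⟨ s≤s (s≤s (m≤n+m (suc p) p)) ⟩
      suc (suc (p + suc p))  ≡⟨ regroup p ⟩
      1 + suc p * 2          ≤⟨ +-mono-≤ 1≤t (*-monoʳ-≤ (suc p) b≥2) ⟩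
      t + suc p * b          ∎)
    where open ≤-Reasoning
          regroup : ∀ p → suc (suc (p + suc p)) ≡ 1 + suc p * 2
          regroup = solve-∀

  α≡1⇒1≤t : ∀ a t v → α a t v ≡ 1 → 1 ≤ t
  α≡1⇒1≤t a zero    v α≡1 = ⊥-elim (0≢1+n (trans (sym (α-zero a v)) α≡1))
  α≡1⇒1≤t a (suc t) v _   = s≤s z≤n

  -- The closing inequality is supplied as `finish`, so the same
  -- step serves the bound and its strict version.
  noCarryStep : ∀ w e a h t' → 2 ≤ w → (∀ {w'} → w' < w → Bounded w') →
    h ≡ t' + w / b * b → w % b ≤ t' → t' < b →
    (∀ X → + 0 Z.≤ X → + (w % b) Z.+ + t' Z.- + b Z.≤ X →
       + (w % b) Z.* + t' Z.+ e Z.≤ + L b Z.* + (w % b) Z.+ (+ b Z.- + L b) Z.* X) →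
    T a w h Z.+ e Z.≤ + L b Z.* + w
  noCarryStep w e a h t' 2≤w rec h≡ t≤t' t'<b finish = begin
      T a w h Z.+ e
        ≡⟨ cong (Z._+ e) (T-decomposition a w h t p t' p w≡ h≡) ⟩
      Σℤ b (λ v → (+ t' Z.- + b Z.* + β t' v) Z.* (+ p Z.+ + α a t v) Z.+ T (count v a) (p + α a t v) (p + β t' v)) Z.+ e
        ≤⟨ ZP.+-monoˡ-≤ e (Σℤ-mono b _ _ (λ v v<b → ZP.+-monoʳ-≤ ((+ t' Z.- + b Z.* + β t' v) Z.* (+ p Z.+ + α a t v))
             (subBound (count v a) p (α a t v) (β t' v) (α≤1 a t v (<⇒≤ t<b)) (β≤1 t' v t'<b v<b)
               (rec (quot< w (≤-trans (s≤s z≤n) 2≤w)))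
               (λ α≡1 _ → rec (quot+1< w t p w≡ 2≤w (α≡1⇒1≤t a t v α≡1)))))) ⟩
      Σℤ b (termBound t' p (α a t) (β t')) Z.+ e
        ≤⟨ collectTerms (α a t) (β t') t t' p w e w≡ Σα≡ Σβ≡
             (finish (Γ (α a t) (β t')) (Γ≥0 (α a t) (β t'))
               (Γ≥ (α a t) (β t') t t' Σα≡ Σβ≡ (λ v _ → α≤1 a t v (<⇒≤ t<b)) (λ v v<b → β≤1 t' v t'<b v<b))) ⟩
      + L b Z.* + w ∎
    where
      open ZP.≤-Reasoning
      t = w % b
      p = w / b
      w≡ = euclid w
      t<b = rem<b w
      Σα≡ = Σα a w t p w≡
      Σβ≡ = Σβ h t' p h≡

  carryStep : ∀ w a → 2 ≤ w → (∀ {w'} → w' < w → Bounded w') → suc (w % b) ≡ b →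
    T a w (suc w) Z.≤ + L b Z.* + w
  carryStep w a 2≤w rec t+1≡b = begin
      T a w (suc w)
        ≡⟨ T-decomposition a w (suc w) t p 0 (suc p) w≡ h≡ ⟩
      Σℤ b (λ v → (+ 0 Z.- + b Z.* + β 0 v) Z.* (+ p Z.+ + α a t v) Z.+ T (count v a) (p + α a t v) (suc p + β 0 v))
        ≤⟨ Σℤ-mono b _ _ termwise ⟩
      Σℤ b (λ v → + L b Z.* (+ p Z.+ + α a t v))
        ≡⟨ Σℤ-ext b _ _ (λ v _ → cong (λ z → + L b Z.* z) (trans (sym (ZP.pos-+ p (α a t v))) (cong +_ (sym (windowCount-digits a w t p v w≡))))) ⟩
      Σℤ b (λ v → + L b Z.* + windowCount a w v)
        ≡⟨ Σℤ-scale b (+ L b) (λ v → + windowCount a w v) ⟩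
      + L b Z.* Σℤ b (λ v → + windowCount a w v)
        ≡⟨ cong (λ z → + L b Z.* z) (trans (sym (Σℤ-pos b (windowCount a w))) (cong +_ (Σwindow a w))) ⟩
      + L b Z.* + w ∎
    where
      open ZP.≤-Reasoning
      t = w % b
      p = w / b
      w≡ = euclid w
      h≡ : suc w ≡ 0 + suc p * b
      h≡ = trans (cong suc w≡) (cong (_+ p * b) t+1≡b)
      vanish : ∀ B X T → (Z.+ 0 Z.- B Z.* Z.+ 0) Z.* X Z.+ T ≡ T
      vanish = ZS.solve-∀
      termwise : ∀ v → v < b →
        (+ 0 Z.- + b Z.* + β 0 v) Z.* (+ p Z.+ + α a t v) Z.+ T (count v a) (p + α a t v) (suc p + β 0 v)
          Z.≤ + L b Z.* (+ p Z.+ + α a t v)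
      termwise v v<b rewrite β-zero v v<b | +-identityʳ p =
        subst (Z._≤ + L b Z.* (+ p Z.+ + α a t v)) (sym (vanish (+ b) (+ p Z.+ + α a t v) _))
          (carryBound (count v a) p (α a t v) (α≤1 a t v (<⇒≤ (rem<b w))) (rec (quot< w (≤-trans (s≤s z≤n) 2≤w)))
            (λ _ → rec (quot+1< w t p w≡ 2≤w (≤-pred (subst (2 ≤_) (sym t+1≡b) b≥2)))))

  finishBound : ∀ t t' → t ≤ t' → t' ≤ suc t → t' < b → ∀ X → + 0 Z.≤ X → + t Z.+ + t' Z.- + b Z.≤ X →
    + t Z.* + t' Z.+ + 0 Z.≤ + L b Z.* + t Z.+ (+ b Z.- + L b) Z.* X
  finishBound t t' t≤t' t'≤t+1 t'<b X X≥0 X≥ =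
    ≤-+0 (lastDigitBound b (L b) t t' X X≥0 X≥ t≤t' t'≤t+1 (<⇒≤ t'<b) (≤2L b) (L≤ b))

  -- strong induction: for w ≥ 2 the subproblems have sizes w / b and w / b + 1
  bounded : ∀ w → Bounded w
  bounded = <-rec Bounded step
    where
      step : ∀ w → (∀ {w'} → w' < w → Bounded w') → Bounded w
      step zero             _   = bounded-zero
      step (suc zero)       _   = bounded-one
      step w@(suc (suc _)) rec a = equalShifts , nextShift
        where
          2≤w : 2 ≤ w
          2≤w = s≤s (s≤s z≤n)
          t = w % b
          equalShifts : T a w w Z.≤ + L b Z.* + w
          equalShifts = +0-≤ (noCarryStep w (+ 0) a w t 2≤w rec (euclid w) ≤-refl (rem<b w)
                                  (finishBound t t ≤-refl (n≤1+n t) (rem<b w)))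
          nextShift : T a w (suc w) Z.≤ + L b Z.* + w
          nextShift with m≤n⇒m<n∨m≡n (rem<b w)
          ... | inj₁ t+1<b = +0-≤ (noCarryStep w (+ 0) a (suc w) (suc t) 2≤w rec (cong suc (euclid w)) (n≤1+n t) t+1<b
                                       (finishBound t (suc t) (n≤1+n t) ≤-refl t+1<b))
          ... | inj₂ t+1≡b = carryStep w a 2≤w rec t+1≡b

  fromT : ∀ k m e → k ≤ m → T (m ∸ k) k k Z.+ + e Z.≤ + L b Z.* + k →
    S b (m + k) + S b (m ∸ k) + e ≤ 2 * S b m + L b * k
  fromT k m e k≤m T≤ = ZP.drop‿+≤+ (≤-byDiff _ _ _ difference (diff≥0 T≤))
    where
      a = m ∸ k
      T≡ : T a k k ≡ + S b (m + k) Z.- + S b m Z.- + S b m Z.+ + S b a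
      T≡ = cong (λ z → + S b (z + k) Z.- + S b z Z.- + S b z Z.+ + S b a) (m∸n+n≡m k≤m)
      identity : ∀ X Y Z' D E → D Z.- (X Z.- Y Z.- Y Z.+ Z' Z.+ E) ≡ ((Y Z.+ (Y Z.+ Z.+ 0)) Z.+ D) Z.- (X Z.+ Z' Z.+ E)
      identity = ZS.solve-∀
      difference : + (2 * S b m + L b * k) Z.- + (S b (m + k) + S b a + e) ≡ + L b Z.* + k Z.- (T a k k Z.+ + e)
      difference = begin
        + (2 * S b m + L b * k) Z.- + (S b (m + k) + S b a + e)
          ≡⟨ cong₂ Z._-_ (trans (ZP.pos-+ (2 * S b m) (L b * k)) (cong₂ Z._+_ (trans (ZP.pos-+ (S b m) (S b m + 0)) (cong (λ z → + S b m Z.+ z) (ZP.pos-+ (S b m) 0))) (ZP.pos-* (L b) k)))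
                         (trans (ZP.pos-+ (S b (m + k) + S b a) e) (cong (Z._+ + e) (ZP.pos-+ (S b (m + k)) (S b a)))) ⟩
        (+ S b m Z.+ (+ S b m Z.+ + 0)) Z.+ + L b Z.* + k Z.- (+ S b (m + k) Z.+ + S b a Z.+ + e)
          ≡⟨ sym (identity (+ S b (m + k)) (+ S b m) (+ S b a) (+ L b Z.* + k) (+ e)) ⟩
        + L b Z.* + k Z.- (+ S b (m + k) Z.- + S b m Z.- + S b m Z.+ + S b a Z.+ + e)
          ≡⟨ cong (λ z → + L b Z.* + k Z.- (z Z.+ + e)) (sym T≡) ⟩
        + L b Z.* + k Z.- (T a k k Z.+ + e) ∎
        where open ≡-Reasoning

  upperBound : ∀ k m → k ≤ m → S b (m + k) + S b (m ∸ k) ≤ 2 * S b m + L b * k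
  upperBound k m k≤m = subst (_≤ 2 * S b m + L b * k) (+-identityʳ _)
    (fromT k m 0 k≤m (≤-+0 (proj₁ (bounded k (m ∸ k)))))

module StrictBound (b : ℕ) .{{_ : NonZero b}} (b≥2 : 2 ≤ b) (odd : b % 2 ≡ 1) where

  open Digits b b≥2
  open SecondDifference b b≥2
  open UpperBound b b≥2

  StrictlyBounded : ℕ → Set
  StrictlyBounded w = ∀ a → T a w w Z.+ + 1 Z.≤ + L b Z.* + w

  strictly-one : StrictlyBounded 1
  strictly-one a = T-one≤ a 1 1 (begin
      s b (a + 1) + 1      ≡⟨ cong (λ z → s b z + 1) (+-comm a 1) ⟩
      s b (suc a) + 1      ≤⟨ +-monoˡ-≤ 1 (s-suc≤ a) ⟩
      suc (s b a) + 1      ≡⟨ +-comm (suc (s b a)) 1 ⟩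
      2 + s b a            ≡⟨ +-comm 2 (s b a) ⟩
      s b a + 2            ≤⟨ +-monoʳ-≤ (s b a) (2≤L b (odd⇒3≤ b b≥2 odd)) ⟩
      s b a + L b          ∎)
    where open ≤-Reasoning

  -- last digit 0: every term of the decomposition is T(c_v(a), p, p) ≤ L p - 1, and
  -- b (L p - 1) + 1 ≤ L p b
  zeroDigitStep : ∀ w → w % b ≡ 0 → 1 ≤ w / b → StrictlyBounded (w / b) → StrictlyBounded w
  zeroDigitStep w t≡0 1≤p strictP a = begin
      T a w w Z.+ + 1
        ≡⟨ cong (Z._+ + 1) (T-decomposition a w w 0 p 0 p w≡ w≡) ⟩
      Σℤ b (λ v → (+ 0 Z.- + b Z.* + β 0 v) Z.* (+ p Z.+ + α a 0 v) Z.+ T (count v a) (p + α a 0 v) (p + β 0 v)) Z.+ + 1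
        ≤⟨ ZP.+-monoˡ-≤ (+ 1) (Σℤ-mono b _ _ termwise) ⟩
      Σℤ b (λ _ → + L b Z.* + p Z.- + 1) Z.+ + 1
        ≡⟨ cong (Z._+ + 1) (Σℤ-const b _) ⟩
      + b Z.* (+ L b Z.* + p Z.- + 1) Z.+ + 1
        ≤⟨ ≤-byDiff _ _ _ (identity (+ b) (+ L b) (+ p)) (diff≥0 (+≤+ (≤-trans (s≤s z≤n) b≥2))) ⟩
      + L b Z.* (+ p Z.* + b)
        ≡⟨ cong (λ z → + L b Z.* z) (sym (trans (cong +_ w≡) (ZP.pos-* p b))) ⟩
      + L b Z.* + w ∎
    where
      open ZP.≤-Reasoning
      p = w / b
      w≡ : w ≡ 0 + p * b
      w≡ = trans (euclid w) (cong (_+ p * b) t≡0)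
      vanish : ∀ B X T → (Z.+ 0 Z.- B Z.* Z.+ 0) Z.* X Z.+ T ≡ T
      vanish = ZS.solve-∀
      identity : ∀ b L p → L Z.* (p Z.* b) Z.- (b Z.* (L Z.* p Z.- Z.+ 1) Z.+ Z.+ 1) ≡ b Z.- Z.+ 1
      identity = ZS.solve-∀
      moveOne : ∀ x y → x Z.+ + 1 Z.≤ y → x Z.≤ y Z.- + 1
      moveOne x y le = ≤-byDiff _ _ _ (shift x y) (diff≥0 le)
        where shift : ∀ x y → y Z.- Z.+ 1 Z.- x ≡ y Z.- (x Z.+ Z.+ 1)
              shift = ZS.solve-∀
      termwise : ∀ v → v < b →
        (+ 0 Z.- + b Z.* + β 0 v) Z.* (+ p Z.+ + α a 0 v) Z.+ T (count v a) (p + α a 0 v) (p + β 0 v)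
          Z.≤ + L b Z.* + p Z.- + 1
      termwise v v<b rewrite β-zero v v<b | α-zero a v | +-identityʳ p =
        subst (Z._≤ + L b Z.* + p Z.- + 1) (sym (vanish (+ b) _ _)) (moveOne _ _ (strictP (count v a)))

  finishStrict : ∀ t → 1 ≤ t → t < b → ∀ X → + 0 Z.≤ X → + t Z.+ + t Z.- + b Z.≤ X →
    + t Z.* + t Z.+ + 1 Z.≤ + L b Z.* + t Z.+ (+ b Z.- + L b) Z.* X
  finishStrict t 1≤t t<b X X≥0 X≥ = lastDigitBoundStrict b (L b) t X X≥0 X≥ t<b (odd⇒2L≡1+ b odd) (L≤ b) 1≤t

  -- strong induction; a nonzero last digit uses the non-strict bound for the subproblems
  strictlyBounded : ∀ w → 1 ≤ w → StrictlyBounded w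
  strictlyBounded = <-rec (λ w → 1 ≤ w → StrictlyBounded w) step
    where
      step : ∀ w → (∀ {w'} → w' < w → 1 ≤ w' → StrictlyBounded w') → 1 ≤ w → StrictlyBounded w
      step (suc zero) _ _ = strictly-one
      step w@(suc (suc _)) rec _ with w % b ≟ 0
      ... | yes t≡0 = zeroDigitStep w t≡0 1≤p (rec (quot< w (s≤s z≤n)) 1≤p)
        where 1≤p : 1 ≤ w / b
              1≤p = n≢0⇒n>0 (λ p≡0 → 0≢1+n (sym (trans (euclid w) (cong₂ (λ x y → x + y * b) t≡0 p≡0))))
      ... | no t≢0 = λ a → noCarryStep w (+ 1) a w (w % b) (s≤s (s≤s z≤n)) (λ _ → bounded _) (euclid w) ≤-refl (rem<b w)
                             (finishStrict (w % b) (n≢0⇒n>0 t≢0) (rem<b w))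

  strictUpperBound : ∀ k m → 1 ≤ k → k ≤ m → S b (m + k) + S b (m ∸ k) < 2 * S b m + L b * k
  strictUpperBound k m 1≤k k≤m =
    subst (_≤ 2 * S b m + L b * k) (+-comm _ 1) (fromT k m 1 k≤m (strictlyBounded k 1≤k (m ∸ k)))

-- Part (ii): divide the bound of part (i), with m = n + k, by 2k.
module AverageBound (b : ℕ) .{{_ : NonZero b}} (b≥2 : 2 ≤ b) where

  open UpperBound b b≥2

  sbar-≡ : ∀ s₀ t d → t ∸ s₀ ≡ suc d → sbar b s₀ t ≡ (+ S b t Z.- + S b s₀) ℚ./ suc d
  sbar-≡ s₀ t d t-s₀≡ with t ∸ s₀ | t-s₀≡
  ... | .(suc d) | refl = refl

  averageUpperBound : ∀ n k → 1 ≤ k →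
    sbar b n (n + 2 * k) ℚ.≤ sbar b n (n + k) ℚ.+ ½ ℚ.* (+ L b ℚ./ 1)
  averageUpperBound n (suc k') _ =
    subst₂ ℚ._≤_ (sym (sbar-≡ n (n + 2 * K) (k' + suc (k' + 0)) (m+n∸m≡n n (2 * K))))
                 (cong (ℚ._+ ½ ℚ.* (+ L b ℚ./ 1)) (sym (sbar-≡ n (n + K) k' (m+n∸m≡n n K))))
      (averageBound (+ S b (n + 2 * K) Z.- + S b n) (+ S b (n + K) Z.- + S b n) (+ L b) k' differences)
    where
      K = suc k'
      inℕ : S b (n + 2 * K) + S b n ≤ 2 * S b (n + K) + L b * K
      inℕ = subst₂ (λ x y → S b x + S b y ≤ 2 * S b (n + K) + L b * K) (regroup n K) (m+n∸n≡m n K)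
              (upperBound K (n + K) (m≤n+m K n))
        where regroup : ∀ n K → n + K + K ≡ n + 2 * K
              regroup = solve-∀
      inℤ : + S b (n + 2 * K) Z.+ + S b n Z.≤ (+ S b (n + K) Z.+ + S b (n + K)) Z.+ + L b Z.* + K
      inℤ = subst₂ Z._≤_ (ZP.pos-+ (S b (n + 2 * K)) (S b n))
              (trans (ZP.pos-+ (2 * S b (n + K)) (L b * K))
                (cong₂ Z._+_ (trans (ZP.pos-+ (S b (n + K)) (S b (n + K) + 0)) (cong (λ z → + S b (n + K) Z.+ + z) (+-identityʳ (S b (n + K)))))
                             (ZP.pos-* (L b) K)))
              (+≤+ inℕ)
      identity : ∀ X N Y Lk → (Y Z.- N Z.+ (Y Z.- N)) Z.+ Lk Z.- (X Z.- N) ≡ (Y Z.+ Y) Z.+ Lk Z.- (X Z.+ N)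
      identity = ZS.solve-∀
      differences : + S b (n + 2 * K) Z.- + S b n Z.≤ (+ S b (n + K) Z.- + S b n Z.+ (+ S b (n + K) Z.- + S b n)) Z.+ + L b Z.* + K
      differences = ≤-byDiff _ _ _ (identity (+ S b (n + 2 * K)) (+ S b n) (+ S b (n + K)) (+ L b Z.* + K)) (diff≥0 inℤ)

module Sharpness (b : ℕ) .{{_ : NonZero b}} (b≥2 : 2 ≤ b) where

  open Digits b b≥2
  open SecondDifference b b≥2

  Δ≡T : ∀ k → Δ b k k ≡ T 0 k k
  Δ≡T k = trans (cong (λ z → (+ S b (k + k) Z.+ + S b z) Z.- + 2 Z.* + S b k) (n∸n≡0 k)) (identity (+ S b (k + k)) (+ S b k))
    where identity : ∀ A B → (A Z.+ Z.+ 0) Z.- Z.+ 2 Z.* B ≡ A Z.- B Z.- B Z.+ Z.+ 0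
          identity = ZS.solve-∀

  1≤half : ∀ d → 2 ≤ suc (d + d) → 1 ≤ d
  1≤half zero    (s≤s ())
  1≤half (suc d) _ = s≤s z≤n

  -- b = 2d: numbers below b are single digits, so S(2d) - 2 S(d) = d² = L d exactly.
  module Even (d : ℕ) (b≡ : b ≡ d + d) (L≡ : L b ≡ d) where

    s-single : ∀ n → n < b → s b n ≡ n
    s-single n n<b = trans (cong (s b) (sym (+-identityʳ n))) (trans (s-digit n 0 n<b) (+-identityʳ n))

    S-singleDigits : ∀ e N → e + N ≤ b → S b (e + N) ≡ S b e + e * N + S b N
    S-singleDigits e zero _ = trans (cong (S b) (+-identityʳ e)) (noShift (S b e) e)
      where noShift : ∀ x e → x ≡ x + e * 0 + 0
            noShift = solve-∀
    S-singleDigits e (suc N) e+N<b = begin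
        S b (e + suc N)                  ≡⟨ cong (S b) (+-suc e N) ⟩
        S b (e + N) + s b (e + N)        ≡⟨ cong₂ _+_ (S-singleDigits e N (<⇒≤ e+N<b')) (s-single (e + N) e+N<b') ⟩
        S b e + e * N + S b N + (e + N)  ≡⟨ regroup (S b e) e N (S b N) ⟩
        S b e + e * suc N + (S b N + N)  ≡⟨ cong (λ z → S b e + e * suc N + (S b N + z)) (sym (s-single N N<b)) ⟩
        S b e + e * suc N + S b (suc N)  ∎
      where
        open ≡-Reasoning
        e+N<b' : e + N < b
        e+N<b' = subst (_≤ b) (+-suc e N) e+N<b
        N<b : N < b
        N<b = ≤-<-trans (m≤n+m N e) e+N<b'
        regroup : ∀ x e N y → x + e * N + y + (e + N) ≡ x + e * suc N + (y + N)
        regroup = solve-∀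

    Δ-even : Δ b d d ≡ + L b Z.* + d Z.- + 0
    Δ-even = begin
      Δ b d d                                                ≡⟨ Δ≡T d ⟩
      + S b (d + d) Z.- + S b d Z.- + S b d Z.+ + 0          ≡⟨ cong (λ z → + z Z.- + S b d Z.- + S b d Z.+ + 0) (S-singleDigits d d (≤-reflexive (sym b≡))) ⟩
      + (S b d + d * d + S b d) Z.- + S b d Z.- + S b d Z.+ + 0
        ≡⟨ cong (λ z → z Z.- + S b d Z.- + S b d Z.+ + 0) inℤ ⟩
      + S b d Z.+ + d Z.* + d Z.+ + S b d Z.- + S b d Z.- + S b d Z.+ + 0 ≡⟨ cancel (+ S b d) (+ d) ⟩
      + d Z.* + d Z.- + 0                                    ≡⟨ cong (λ z → + z Z.* + d Z.- + 0) (sym L≡) ⟩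
      + L b Z.* + d Z.- + 0                                  ∎
      where
        open ≡-Reasoning
        inℤ : + (S b d + d * d + S b d) ≡ + S b d Z.+ + d Z.* + d Z.+ + S b d
        inℤ = trans (ZP.pos-+ (S b d + d * d) (S b d))
                (cong (Z._+ + S b d) (trans (ZP.pos-+ (S b d) (d * d)) (cong (λ z → + S b d Z.+ z) (ZP.pos-* d d))))
        cancel : ∀ x d → x Z.+ d Z.* d Z.+ x Z.- x Z.- x Z.+ Z.+ 0 ≡ d Z.* d Z.- Z.+ 0
        cancel = ZS.solve-∀

    sharpEven : ∀ c → c ℚ.< (+ L b ℚ./ 1) → ∃₂ λ (k m : ℕ) → k ≤ m × c ℚ.* (+ k ℚ./ 1) ℚ.< (Δ b m k ℚ./ 1)
    sharpEven c c<L = d , d , ≤-refl , beatsConstant c (L b) d 0 (Δ b d d) c<L Δ-even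
                                         (1≤half d (≤-trans b≥2 (subst (_≤ suc (d + d)) (sym b≡) (n≤1+n _))))

  -- b = 2d + 1: the numbers k_j with j digits all equal to d satisfy T(0,k_j,k_j) = L k_j - j d,
  -- and j d is negligible against k_j (which grows at least like d j²/2).
  module Odd (d : ℕ) (b≡ : b ≡ suc (d + d)) (L≡ : L b ≡ suc d) where

    repdigit : ℕ → ℕ
    repdigit zero    = 0
    repdigit (suc j) = d + repdigit j * b

    1≤d : 1 ≤ d
    1≤d = 1≤half d (subst (2 ≤_) b≡ b≥2)

    d+1<b : suc d < b
    d+1<b = subst (suc d <_) (sym b≡) (s≤s (m<m+n d 1≤d))

    -- for a = 0 and last digits d and t' ≤ d + 1, the α- and β-supports are disjoint:
    -- α_v = 0 for v ≥ d and β_v = 0 for v < d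
    α-vanishes : ∀ v → v < b → d ≤ v → α 0 d v ≡ 0
    α-vanishes v v<b d≤v = trans (cong (_∸ (b ∸ suc v) / b) (m<n⇒m/n≡0 below)) (0∸n≡0 ((b ∸ suc v) / b))
      where below : b ∸ suc v + d < b
            below = begin-strict
              b ∸ suc v + d      ≤⟨ +-monoʳ-≤ (b ∸ suc v) d≤v ⟩
              b ∸ suc v + v      <⟨ +-monoʳ-< (b ∸ suc v) (n<1+n v) ⟩
              b ∸ suc v + suc v  ≡⟨ m∸n+n≡m v<b ⟩
              b                  ∎
              where open ≤-Reasoning

    β-vanishes : ∀ t' v → t' ≤ suc d → v < d → β t' v ≡ 0
    β-vanishes t' v t'≤ v<d = m<n⇒m/n≡0 (begin-strict
        v + t'       <⟨ +-monoˡ-< t' v<d ⟩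
        d + t'       ≤⟨ +-monoʳ-≤ d t'≤ ⟩
        d + suc d    ≡⟨ +-suc d d ⟩
        suc (d + d)  ≡⟨ sym b≡ ⟩
        b            ∎)
      where open ≤-Reasoning

    αβ≡0 : ∀ t' v → t' ≤ suc d → v < b → α 0 d v * β t' v ≡ 0
    αβ≡0 t' v t'≤ v<b with v <? d
    ... | yes v<d = trans (cong (α 0 d v *_) (β-vanishes t' v t'≤ v<d)) (*-zeroʳ (α 0 d v))
    ... | no v≮d  = cong (_* β t' v) (α-vanishes v v<b (≮⇒≥ v≮d))

    Exact : ℕ → ℕ → Set
    Exact p J = (T 0 p p Z.+ + J ≡ + L b Z.* + p) × (T 0 p (suc p) ≡ + L b Z.* + p)

    termValue : ∀ p J → Exact p J → ∀ t' v → t' ≤ suc d → v < b →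
      T (count v 0) (p + α 0 d v) (p + β t' v) ≡ + L b Z.* + p Z.- + J Z.* (Z.+ 1 Z.- + α 0 d v Z.- + β t' v)
    termValue p J (short , carry) t' v t'≤ v<b
      with α 0 d v | β t' v | α≤1 0 d v (<⇒≤ (<-trans (n<1+n d) d+1<b)) | β≤1 t' v (≤-<-trans t'≤ d+1<b) v<b | αβ≡0 t' v t'≤ v<b
    ... | zero | zero | _ | _ | _ rewrite count-zero v v<b | +-identityʳ p =
      trans (sym (cancel (T 0 p p) (+ J))) (trans (cong (Z._- + J) short) (expand (+ L b Z.* + p) (+ J)))
      where cancel : ∀ T J → T Z.+ J Z.- J ≡ T
            cancel = ZS.solve-∀
            expand : ∀ X J → X Z.- J ≡ X Z.- J Z.* (Z.+ 1 Z.- Z.+ 0 Z.- Z.+ 0)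
            expand = ZS.solve-∀
    ... | suc zero | zero | _ | _ | _ rewrite count-zero v v<b | +-identityʳ p | +-comm p 1 =
      trans (T-sym 0 (suc p) p) (trans carry (expand (+ L b Z.* + p) (+ J)))
      where expand : ∀ X J → X ≡ X Z.- J Z.* (Z.+ 1 Z.- Z.+ 1 Z.- Z.+ 0)
            expand = ZS.solve-∀
    ... | zero | suc zero | _ | _ | _ rewrite count-zero v v<b | +-identityʳ p | +-comm p 1 =
      trans carry (expand (+ L b Z.* + p) (+ J))
      where expand : ∀ X J → X ≡ X Z.- J Z.* (Z.+ 1 Z.- Z.+ 0 Z.- Z.+ 1)
            expand = ZS.solve-∀
    ... | suc zero    | suc zero    | _ | _ | ()
    ... | suc (suc _) | _ | s≤s () | _ | _
    ... | _ | suc (suc _) | _ | s≤s () | _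

    exactDecomposition : ∀ p J → Exact p J → ∀ t' h → t' ≤ suc d → h ≡ t' + p * b →
      T 0 (d + p * b) h ≡ + b Z.* (+ t' Z.* + p Z.+ + L b Z.* + p Z.- + J) Z.+ (+ t' Z.+ + J) Z.* + d
                            Z.+ (+ J Z.- + b Z.* + p) Z.* + t'
    exactDecomposition p J ex t' h t'≤ h≡ = begin
        T 0 (d + p * b) h
          ≡⟨ T-decomposition 0 (d + p * b) h d p t' p refl h≡ ⟩
        Σℤ b (λ v → (+ t' Z.- + b Z.* + βv v) Z.* (+ p Z.+ + αv v) Z.+ T (count v 0) (p + αv v) (p + βv v))
          ≡⟨ Σℤ-ext b _ _ (λ v v<b → cong (λ z → (+ t' Z.- + b Z.* + βv v) Z.* (+ p Z.+ + αv v) Z.+ z) (termValue p J ex t' v t'≤ v<b)) ⟩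
        Σℤ b (λ v → (+ t' Z.- + b Z.* + βv v) Z.* (+ p Z.+ + αv v) Z.+ (+ L b Z.* + p Z.- + J Z.* (Z.+ 1 Z.- + αv v Z.- + βv v)))
          ≡⟨ Σℤ-ext b _ _ (λ v _ → expand (+ t') (+ b) (+ βv v) (+ p) (+ αv v) (+ L b) (+ J)) ⟩
        Σℤ b (λ v → K Z.+ A Z.* + αv v Z.+ B Z.* + βv v Z.+ C Z.* (+ αv v Z.* + βv v))
          ≡⟨ Σℤ-linear b K A B C (λ v → + αv v) (λ v → + βv v) (λ v → + αv v Z.* + βv v) ⟩
        + b Z.* K Z.+ A Z.* Σℤ b (λ v → + αv v) Z.+ B Z.* Σℤ b (λ v → + βv v) Z.+ C Z.* Σℤ b (λ v → + αv v Z.* + βv v)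
          ≡⟨ cong₂ (λ x y → + b Z.* K Z.+ A Z.* x Z.+ B Z.* y Z.+ C Z.* Σℤ b (λ v → + αv v Z.* + βv v))
                (trans (sym (Σℤ-pos b αv)) (cong +_ (Σα 0 (d + p * b) d p refl))) (trans (sym (Σℤ-pos b βv)) (cong +_ (Σβ h t' p h≡))) ⟩
        + b Z.* K Z.+ A Z.* + d Z.+ B Z.* + t' Z.+ C Z.* Σℤ b (λ v → + αv v Z.* + βv v)
          ≡⟨ cong (λ z → + b Z.* K Z.+ A Z.* + d Z.+ B Z.* + t' Z.+ C Z.* z) disjoint ⟩
        + b Z.* K Z.+ A Z.* + d Z.+ B Z.* + t' Z.+ C Z.* + 0
          ≡⟨ trans (cong (λ z → + b Z.* K Z.+ A Z.* + d Z.+ B Z.* + t' Z.+ z) (ZP.*-zeroʳ C)) (ZP.+-identityʳ _) ⟩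
        + b Z.* K Z.+ A Z.* + d Z.+ B Z.* + t' ∎
      where
        open ≡-Reasoning
        αv = α 0 d
        βv = β t'
        K = + t' Z.* + p Z.+ + L b Z.* + p Z.- + J
        A = + t' Z.+ + J
        B = + J Z.- + b Z.* + p
        C = Z.- + b
        expand : ∀ t' B β p α L J → (t' Z.- B Z.* β) Z.* (p Z.+ α) Z.+ (L Z.* p Z.- J Z.* (Z.+ 1 Z.- α Z.- β))
                   ≡ (t' Z.* p Z.+ L Z.* p Z.- J) Z.+ (t' Z.+ J) Z.* α Z.+ (J Z.- B Z.* p) Z.* β Z.+ (Z.- B) Z.* (α Z.* β)
        expand = ZS.solve-∀
        disjoint : Σℤ b (λ v → + αv v Z.* + βv v) ≡ + 0
        disjoint = trans (Σℤ-ext b _ _ (λ v v<b → trans (sym (ZP.pos-* (αv v) (βv v))) (cong +_ (αβ≡0 t' v t'≤ v<b))))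
                         (trans (Σℤ-const b (+ 0)) (ZP.*-zeroʳ (+ b)))

    -- passing from p to d + p b (one more digit d): with b = 2d + 1 and L = d + 1 the
    -- deficit grows by exactly d, and the shift by one more stays exact
    module NextDigit (p J : ℕ) (ex : Exact p J) where

      b≡ℤ : + b ≡ Z.+ 1 Z.+ (+ d Z.+ + d)
      b≡ℤ = cong +_ b≡
      L≡ℤ : + L b ≡ Z.+ 1 Z.+ + d
      L≡ℤ = cong +_ L≡

      close : (Z.+ 1 Z.+ + d) Z.* (+ d Z.+ + p Z.* (Z.+ 1 Z.+ (+ d Z.+ + d))) ≡ + L b Z.* + (d + p * b)
      close = begin
        (Z.+ 1 Z.+ + d) Z.* (+ d Z.+ + p Z.* (Z.+ 1 Z.+ (+ d Z.+ + d))) ≡⟨ sym (cong₂ (λ L B → L Z.* (+ d Z.+ + p Z.* B)) L≡ℤ b≡ℤ) ⟩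
        + L b Z.* (+ d Z.+ + p Z.* + b)                                  ≡⟨ cong (λ z → + L b Z.* z) (sym next≡) ⟩
        + L b Z.* + (d + p * b)                                          ∎
        where open ≡-Reasoning
              next≡ : + (d + p * b) ≡ + d Z.+ + p Z.* + b
              next≡ = trans (ZP.pos-+ d (p * b)) (cong (λ z → + d Z.+ z) (ZP.pos-* p b))

      short : T 0 (d + p * b) (d + p * b) Z.+ + (d + J) ≡ + L b Z.* + (d + p * b)
      short = begin
        T 0 (d + p * b) (d + p * b) Z.+ + (d + J)
          ≡⟨ cong₂ Z._+_ (exactDecomposition p J ex d (d + p * b) (n≤1+n d) refl) (ZP.pos-+ d J) ⟩
        + b Z.* (+ d Z.* + p Z.+ + L b Z.* + p Z.- + J) Z.+ (+ d Z.+ + J) Z.* + d Z.+ (+ J Z.- + b Z.* + p) Z.* + d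
          Z.+ (+ d Z.+ + J)
          ≡⟨ cong₂ (λ B L → B Z.* (+ d Z.* + p Z.+ L Z.* + p Z.- + J) Z.+ (+ d Z.+ + J) Z.* + d
                              Z.+ (+ J Z.- B Z.* + p) Z.* + d Z.+ (+ d Z.+ + J)) b≡ℤ L≡ℤ ⟩
        _ ≡⟨ identity (+ d) (+ p) (+ J) ⟩
        (Z.+ 1 Z.+ + d) Z.* (+ d Z.+ + p Z.* (Z.+ 1 Z.+ (+ d Z.+ + d))) ≡⟨ close ⟩
        + L b Z.* + (d + p * b) ∎
        where
          open ≡-Reasoning
          identity : ∀ d p J → (Z.+ 1 Z.+ (d Z.+ d)) Z.* (d Z.* p Z.+ (Z.+ 1 Z.+ d) Z.* p Z.- J) Z.+ (d Z.+ J) Z.* d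
                       Z.+ (J Z.- (Z.+ 1 Z.+ (d Z.+ d)) Z.* p) Z.* d Z.+ (d Z.+ J)
                       ≡ (Z.+ 1 Z.+ d) Z.* (d Z.+ p Z.* (Z.+ 1 Z.+ (d Z.+ d)))
          identity = ZS.solve-∀

      carry : T 0 (d + p * b) (suc (d + p * b)) ≡ + L b Z.* + (d + p * b)
      carry = begin
        T 0 (d + p * b) (suc (d + p * b))
          ≡⟨ exactDecomposition p J ex (suc d) (suc (d + p * b)) ≤-refl refl ⟩
        + b Z.* (+ suc d Z.* + p Z.+ + L b Z.* + p Z.- + J) Z.+ (+ suc d Z.+ + J) Z.* + d Z.+ (+ J Z.- + b Z.* + p) Z.* + suc d
          ≡⟨ cong₂ (λ B L → B Z.* (+ suc d Z.* + p Z.+ L Z.* + p Z.- + J) Z.+ (+ suc d Z.+ + J) Z.* + d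
                              Z.+ (+ J Z.- B Z.* + p) Z.* + suc d) b≡ℤ L≡ℤ ⟩
        _ ≡⟨ identity (+ d) (+ p) (+ J) ⟩
        (Z.+ 1 Z.+ + d) Z.* (+ d Z.+ + p Z.* (Z.+ 1 Z.+ (+ d Z.+ + d))) ≡⟨ close ⟩
        + L b Z.* + (d + p * b) ∎
        where
          open ≡-Reasoning
          identity : ∀ d p J → (Z.+ 1 Z.+ (d Z.+ d)) Z.* ((Z.+ 1 Z.+ d) Z.* p Z.+ (Z.+ 1 Z.+ d) Z.* p Z.- J) Z.+ ((Z.+ 1 Z.+ d) Z.+ J) Z.* d
                       Z.+ (J Z.- (Z.+ 1 Z.+ (d Z.+ d)) Z.* p) Z.* (Z.+ 1 Z.+ d)
                       ≡ (Z.+ 1 Z.+ d) Z.* (d Z.+ p Z.* (Z.+ 1 Z.+ (d Z.+ d)))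
          identity = ZS.solve-∀

    repdigit-exact : ∀ j → Exact (repdigit j) (j * d)
    repdigit-exact zero    = trans (cong (Z._+ + 0) (T-zero 0 0)) (sym (ZP.*-zeroʳ (+ L b))) ,
                             trans (T-zero 0 1) (sym (ZP.*-zeroʳ (+ L b)))
    repdigit-exact (suc j) = NextDigit.short (repdigit j) (j * d) (repdigit-exact j) ,
                             NextDigit.carry (repdigit j) (j * d) (repdigit-exact j)

    -- growth: 2 k_j ≥ d j (j + 1), from k_{j+1} = d + b k_j ≥ d + 2 k_j
    repdigit-growth : ∀ j → d * (j * suc j) ≤ repdigit j + repdigit j
    repdigit-growth zero    = ≤-reflexive (*-zeroʳ d)
    repdigit-growth (suc j) = +-cancelʳ-≤ (d * j) _ _ (begin
        d * (suc j * suc (suc j)) + d * j                    ≤⟨ +-monoʳ-≤ (d * (suc j * suc (suc j))) (*-monoʳ-≤ d (m≤m*m j)) ⟩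
        d * (suc j * suc (suc j)) + d * (j * j)              ≡⟨ regroup d j ⟩
        (d + d + d * (j * suc j) + d * (j * suc j)) + d * j  ≤⟨ +-monoˡ-≤ (d * j) (+-mono-≤ (+-monoʳ-≤ (d + d) (repdigit-growth j)) (repdigit-growth j)) ⟩
        (d + d + (k + k) + (k + k)) + d * j                  ≡⟨ cong (_+ d * j) (double d k) ⟩
        (d + k * 2) + (d + k * 2) + d * j                    ≤⟨ +-monoˡ-≤ (d * j) (+-mono-≤ (+-monoʳ-≤ d (*-monoʳ-≤ k b≥2)) (+-monoʳ-≤ d (*-monoʳ-≤ k b≥2))) ⟩
        (d + k * b) + (d + k * b) + d * j                    ∎)
      where
        open ≤-Reasoning
        k = repdigit j
        m≤m*m : ∀ m → m ≤ m * m
        m≤m*m zero    = z≤n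
        m≤m*m (suc m) = m≤m*n (suc m) (suc m)
        regroup : ∀ d j → d * (suc j * suc (suc j)) + d * (j * j) ≡ (d + d + d * (j * suc j) + d * (j * suc j)) + d * j
        regroup = solve-∀
        double : ∀ d k → d + d + (k + k) + (k + k) ≡ (d + k * 2) + (d + k * 2)
        double = solve-∀

    deficit<repdigit : ∀ D → (2 * suc D * d) * suc D < repdigit (2 * suc D)
    deficit<repdigit D = *-cancelˡ-≤ 2 (subst (2 * suc x ≤_) (cong (λ z → k + z) (sym (+-identityʳ k))) (begin
        2 * suc x            ≡⟨ *-suc 2 x ⟩
        2 + 2 * x            ≡⟨ cong (λ z → 2 + z) (regroup (suc D) d) ⟩
        2 + d * (j * j)      ≤⟨ +-monoˡ-≤ (d * (j * j)) 2≤dj ⟩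
        d * j + d * (j * j)  ≡⟨ +-comm (d * j) _ ⟩
        d * (j * j) + d * j  ≡⟨ sym (expand d j) ⟩
        d * (j * suc j)      ≤⟨ repdigit-growth j ⟩
        k + k                ∎))
      where
        open ≤-Reasoning
        j = 2 * suc D
        x = 2 * suc D * d * suc D
        k = repdigit j
        2≤dj : 2 ≤ d * j
        2≤dj = *-mono-≤ 1≤d (*-monoʳ-≤ 2 (s≤s (z≤n {D})))
        regroup : ∀ D d → 2 * (2 * D * d * D) ≡ d * ((2 * D) * (2 * D))
        regroup = solve-∀
        expand : ∀ d j → d * (j * suc j) ≡ d * (j * j) + d * j
        expand = solve-∀

    sharpOdd : ∀ c → c ℚ.< (+ L b ℚ./ 1) → ∃₂ λ (k m : ℕ) → k ≤ m × c ℚ.* (+ k ℚ./ 1) ℚ.< (Δ b m k ℚ./ 1)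
    sharpOdd c c<L = k , k , ≤-refl , beatsConstant c (L b) k (j * d) (Δ b k k) c<L Δ-odd (deficit<repdigit D)
      where
        D = ℚ.denominator-1 c
        j = 2 * suc D
        k = repdigit j
        solveFor : ∀ T J X → T Z.+ J ≡ X → T ≡ X Z.- J
        solveFor T J X eq = trans (sym (cancel T J)) (cong (Z._- J) eq)
          where cancel : ∀ T J → T Z.+ J Z.- J ≡ T
                cancel = ZS.solve-∀
        Δ-odd : Δ b k k ≡ + L b Z.* + k Z.- + (j * d)
        Δ-odd = trans (Δ≡T k) (solveFor _ _ _ (proj₁ (repdigit-exact j)))

  sharp : ∀ c → c ℚ.< (+ L b ℚ./ 1) → ∃₂ λ (k m : ℕ) → k ≤ m × c ℚ.* (+ k ℚ./ 1) ℚ.< (Δ b m k ℚ./ 1)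
  sharp with halves b
  ... | inj₁ (d , b≡ , L≡) = Even.sharpEven d b≡ L≡
  ... | inj₂ (d , b≡ , L≡) = Odd.sharpOdd d b≡ L≡

theorem3 : (b : ℕ) .{{_ : NonZero b}} → 2 ≤ b →
    -- (i) the inequality
    (∀ (k m : ℕ) → k ≤ m → S b (m + k) + S b (m ∸ k) ≤ 2 * S b m + L b * k)
    -- (i) sharpness of the constant
    × (∀ (c : ℚ) → c ℚ.< (+ L b ℚ./ 1) →
         ∃₂ λ (k m : ℕ) → k ≤ m × c ℚ.* (+ k ℚ./ 1) ℚ.< (Δ b m k ℚ./ 1))
    -- (i) strictness for odd b
    × (b % 2 ≡ 1 → ∀ (k m : ℕ) → 1 ≤ k → k ≤ m →
         S b (m + k) + S b (m ∸ k) < 2 * S b m + L b * k)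
    -- (ii)
    × (∀ (n k : ℕ) → 1 ≤ k →
         sbar b n (n + 2 * k) ℚ.≤ sbar b n (n + k) ℚ.+ ½ ℚ.* (+ L b ℚ./ 1))
theorem3 b b≥2 =
  UpperBound.upperBound b b≥2 ,
  Sharpness.sharp b b≥2 ,
  StrictBound.strictUpperBound b b≥2 ,
  AverageBound.averageUpperBound b b≥2
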